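{- Let $n,p,q$ be positive integers with $n>q$. Let $f:\Gamma^{p,q}_n\to\Omega^{p,q}_n$ send a state $\mu$ of $\mathrm{DASEP}(n,p,q)$ to $(w,\lambda)$, where $w\in S_n(1^q0^{n-q})$ has $w_i=1$ iff $\mu_i\neq0$, and $\lambda$ is the partition obtained by sorting the entries of $\mu$ in weakly decreasing order (so $\mu\in S_n^w(\lambda)$). Then $f$ is a lumping of $\mathrm{DASEP}(n,p,q)$ onto the colored Boolean process on $\Omega^{p,q}_n$: for all $y_0,y_1\in\Omega^{p,q}_n$ and every $\mu_0$ with $f(\mu_0)=y_0$, $$\sum_{\mu:\,f(\mu)=y_1}P(\mu_0,\mu)=Q(y_0,y_1),$$ where $P$ and $Q$ are the transition matrices of the DASEP and of the colored Boolean process respectively.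
   Context: Partitions are written as $n$-tuples $(\lambda_1\ge\cdots\ge\lambda_n\ge0)$; $m_i$ denotes the number of parts equal to $i$, $\ell(\lambda)$ the number of positive parts. $S_n(\lambda)$ is the set of rearrangements of $\lambda$; binary words are elements of $S_n(1^q0^{n-q})$; $S_n^w(\lambda)=\{\mu\in S_n(\lambda):\mu_i\ne0\iff w_i\ne0\}$. $\mathrm{DASEP}(n,p,q)$ with parameters $t,u\in[0,1]$: state space $\Gamma^{p,q}_n$ = all $n$-tuples with entries in $\{0,\dots,p\}$ with exactly $q$ nonzero entries; positions cyclic (position $n$ followed by $1$). Transitions $P(\mu,\nu)$: swapping entries $a=\mu_k\ne b=\mu_{k+1}$ at cyclically consecutive positions has probability $\frac{1}{3n}$ if $b>a$ and $\frac{t}{3n}$ if $a>b$; changing one entry $i$ ($1\le i\le p-1$) to $i+1$ has probability $\frac{u}{3n}$; changing one entry $i+1$ ($i\ge1$) to $i$ has probability $\frac{1}{3n}$; other off-diagonal probabilities $0$, diagonal entries make rows sum to $1$. Colored Boolean process on $\Omega^{p,q}_n=\{(w,\lambda): w\in S_n(1^q0^{n-q}),\ \lambda_1\le p,\ \ell(\lambda)=q\}$ with transition matrix $Q$: $Q((w,\lambda),(w,\lambda'))=\frac{m_i u}{3n}$ if $\lambda$ has $m_i\ge1$ parts equal to $i$ and $\lambda'$ is obtained by changing one part equal to $i$ to $i+1$; $Q((w,\lambda),(w,\lambda'))=\frac{m_i}{3n}$ if $\lambda'$ is obtained by changing one part equal to $i$ to $i-1$; $Q((w,\lambda),(w',\lambda))=\frac{1}{3n}$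 if $w'$ is obtained from $w$ by replacing one occurrence of $01$ at cyclically consecutive positions by $10$; $Q((w,\lambda),(w',\lambda))=\frac{t}{3n}$ if $w'$ is obtained by replacing one cyclically consecutive $10$ by $01$; all other off-diagonal entries $0$, diagonal entries make rows sum to $1$ (all resulting states are required to lie in $\Omega^{p,q}_n$).
   Formalization: The parameters t and u take rational values in [0,1] rather than real ones. -}

module Defs where

open import Data.Bool using (Bool; true; false; if_then_else_; _∧_; not)
open import Data.Nat as ℕ using (ℕ; zero; suc; _∸_; _≤ᵇ_; _<ᵇ_; _≡ᵇ_)
open import Data.Nat.Properties using (_<?_)
open import Data.Fin using (Fin; zero; suc; toℕ; fromℕ<)
open import Data.Vec as V using (Vec; []; _∷_; lookup; _[_]≔_)
open import Data.List as L using (List; []; _∷_; filterᵇ; upTo; concatMap; cartesianProduct)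
open import Data.Product using (_×_; _,_)
open import Data.Integer using (+_)
open import Data.Rational using (ℚ; 0ℚ; 1ℚ; _+_; _*_; _-_; _/_)
open import Relation.Nullary using (yes; no)
open import Relation.Binary.PropositionalEquality using (_≡_)

sumℚ : List ℚ → ℚ
sumℚ = L.foldr _+_ 0ℚ

ℕtoℚ : ℕ → ℚ
ℕtoℚ m = + m / 1

[_]·_ : Bool → ℚ → ℚ
[ b ]· x = if b then x else 0ℚ

inv3n : ℕ → ℚ
inv3n zero    = 0ℚ
inv3n (suc m) = + 1 / (3 ℕ.* suc m)

_==v_ : ∀ {n} → Vec ℕ n → Vec ℕ n → Bool
[]       ==v []       = true
(x ∷ xs) ==v (y ∷ ys) = (x ≡ᵇ y) ∧ (xs ==v ys)

-- cyclic successor of a position (position n is followed by position 1)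
next : ∀ {n} → Fin n → Fin n
next {suc m} i with suc (toℕ i) <? suc m
... | yes lt = fromℕ< lt
... | no _   = zero

swapAt : ∀ {n} → Fin n → Vec ℕ n → Vec ℕ n
swapAt k μ = (μ [ k ]≔ lookup μ (next k)) [ next k ]≔ lookup μ k

nonzeros : ∀ {n} → Vec ℕ n → ℕ
nonzeros []       = 0
nonzeros (x ∷ xs) = (if x ≡ᵇ 0 then 0 else 1) ℕ.+ nonzeros xs

allLe : ∀ {n} → ℕ → Vec ℕ n → Bool
allLe p []       = true
allLe p (x ∷ xs) = (x ≤ᵇ p) ∧ allLe p xs

isDecr : ∀ {n} → Vec ℕ n → Bool
isDecr []           = true
isDecr (x ∷ [])     = true
isDecr (x ∷ y ∷ xs) = (y ≤ᵇ x) ∧ isDecr (y ∷ xs)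

insertDesc : ∀ {n} → ℕ → Vec ℕ n → Vec ℕ (suc n)
insertDesc x []       = x ∷ []
insertDesc x (y ∷ ys) = if y ≤ᵇ x then x ∷ y ∷ ys else y ∷ insertDesc x ys

sortDesc : ∀ {n} → Vec ℕ n → Vec ℕ n
sortDesc []       = []
sortDesc (x ∷ xs) = insertDesc x (sortDesc xs)

mult : ∀ {n} → ℕ → Vec ℕ n → ℕ
mult i []       = 0
mult i (x ∷ xs) = (if x ≡ᵇ i then 1 else 0) ℕ.+ mult i xs

replaceFirst : ∀ {n} → ℕ → ℕ → Vec ℕ n → Vec ℕ n
replaceFirst i j []       = []
replaceFirst i j (x ∷ xs) = if x ≡ᵇ i then j ∷ xs else x ∷ replaceFirst i j xs

changePart : ∀ {n} → ℕ → ℕ → Vec ℕ n → Vec ℕ n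
changePart i j λ′ = sortDesc (replaceFirst i j λ′)

allVecs : (n p : ℕ) → List (Vec ℕ n)
allVecs zero    p = [] ∷ []
allVecs (suc n) p = concatMap (λ x → L.map (x ∷_) (allVecs n p)) (upTo (suc p))

isΓ : ∀ {n} → ℕ → ℕ → Vec ℕ n → Bool
isΓ p q μ = allLe p μ ∧ (nonzeros μ ≡ᵇ q)

InΓ : ∀ {n} → ℕ → ℕ → Vec ℕ n → Set
InΓ p q μ = isΓ p q μ ≡ true

Γlist : (n p q : ℕ) → List (Vec ℕ n)
Γlist n p q = filterᵇ (isΓ p q) (allVecs n p)

swapRate : ℚ → ℕ → ℕ → ℚ
swapRate t a b = if a ≡ᵇ b then 0ℚ else (if a <ᵇ b then 1ℚ else t)

Poff : (n p : ℕ) (t u : ℚ) → Vec ℕ n → Vec ℕ n → ℚ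
Poff n p t u μ ν = inv3n n * sumℚ (L.map term (L.allFin n))
  where
  term : Fin n → ℚ
  term k =
      ([ swapAt k μ ==v ν ]· swapRate t (lookup μ k) (lookup μ (next k)))
    + ([ (1 ≤ᵇ lookup μ k) ∧ (suc (lookup μ k) ≤ᵇ p)
         ∧ ((μ [ k ]≔ suc (lookup μ k)) ==v ν) ]· u)
    + ([ (2 ≤ᵇ lookup μ k) ∧ ((μ [ k ]≔ (lookup μ k ∸ 1)) ==v ν) ]· 1ℚ)

-- transition matrix P (diagonal makes rows over Γ sum to 1)
P : (n p q : ℕ) (t u : ℚ) → Vec ℕ n → Vec ℕ n → ℚ
P n p q t u μ ν =
  if μ ==v ν
  then 1ℚ - sumℚ (L.map (Poff n p t u μ) (filterᵇ (λ ν′ → not (μ ==v ν′)) (Γlist n p q)))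
  else Poff n p t u μ ν

isBinary : ∀ {n} → Vec ℕ n → Bool
isBinary = allLe 1

isΩ : ∀ {n} → ℕ → ℕ → Vec ℕ n × Vec ℕ n → Bool
isΩ p q (w , λ′) =
  isBinary w ∧ (nonzeros w ≡ᵇ q) ∧ isDecr λ′ ∧ allLe p λ′ ∧ (nonzeros λ′ ≡ᵇ q)

InΩ : ∀ {n} → ℕ → ℕ → Vec ℕ n × Vec ℕ n → Set
InΩ p q y = isΩ p q y ≡ true

Ωlist : (n p q : ℕ) → List (Vec ℕ n × Vec ℕ n)
Ωlist n p q = filterᵇ (isΩ p q) (cartesianProduct (allVecs n 1) (allVecs n p))

_==Ω_ : ∀ {n} → Vec ℕ n × Vec ℕ n → Vec ℕ n × Vec ℕ n → Bool
(w , λ′) ==Ω (w′ , λ″) = (w ==v w′) ∧ (λ′ ==v λ″)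

Qoff : (n p : ℕ) (t u : ℚ) → Vec ℕ n × Vec ℕ n → Vec ℕ n × Vec ℕ n → ℚ
Qoff n p t u (w , λ′) (w′ , λ″) =
  inv3n n * (([ w ==v w′ ]· sumℚ (L.map partTerm (L.map suc (upTo p))))
            + ([ λ′ ==v λ″ ]· sumℚ (L.map wordTerm (L.allFin n))))
  where
  partTerm : ℕ → ℚ
  partTerm i =
      ([ λ″ ==v changePart i (suc i) λ′ ]· (ℕtoℚ (mult i λ′) * u))
    + ([ λ″ ==v changePart i (i ∸ 1) λ′ ]· ℕtoℚ (mult i λ′))
  wordTerm : Fin n → ℚ
  wordTerm k =
      ([ (lookup w k ≡ᵇ 0) ∧ (lookup w (next k) ≡ᵇ 1) ∧ (swapAt k w ==v w′) ]· 1ℚ)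
    + ([ (lookup w k ≡ᵇ 1) ∧ (lookup w (next k) ≡ᵇ 0) ∧ (swapAt k w ==v w′) ]· t)

Q : (n p q : ℕ) (t u : ℚ) → Vec ℕ n × Vec ℕ n → Vec ℕ n × Vec ℕ n → ℚ
Q n p q t u y y′ =
  if y ==Ω y′
  then 1ℚ - sumℚ (L.map (Qoff n p t u y) (filterᵇ (λ y″ → not (y ==Ω y″)) (Ωlist n p q)))
  else Qoff n p t u y y′

f : ∀ {n} → Vec ℕ n → Vec ℕ n × Vec ℕ n
f μ = (V.map (λ x → if x ≡ᵇ 0 then 0 else 1) μ , sortDesc μ)

{-# OPTIONS --safe #-}
module Submission where

-- A swap at positions k, k+1 of a DASEP state μ₀ with f μ₀ = (w₀, λ₀) leaves λ₀
-- alone and acts on w₀ exactly as the word move of the Boolean process, except when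
-- both entries are nonzero, where it fixes f μ₀. Raising or lowering an entry equal
-- to i fixes w₀ and changes one part i of λ₀; grouping the n positions by their
-- value turns the sum over positions into the sum over i weighted by m_i, which is
-- Q's part term. The moves of Q that would leave Ω (a part above p, a part 1 dropping
-- to 0) have no DASEP counterpart and never reach a state of Ω. The diagonal entries
-- then agree because both rows sum to 1 and the fibres of f partition Γ, so the mass
-- leaving the fibre of y₀ is the same for both chains.

open import Defs
open import Algebra.Bundles using (CommutativeMonoid)
open import Data.Bool using (Bool; true; false; if_then_else_; _∧_; not)
open import Data.Bool.Properties using (∧-assoc; T-≡; ¬-not; not-¬)
open import Data.Empty using (⊥-elim)
open import Data.Fin using (Fin; zero; suc)
import Data.Fin.Properties as Fin
import Data.Integer as ℤ
import Data.Integer.Properties as ℤ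
open import Data.List as L using (List; []; _∷_; _++_; map; filterᵇ; upTo; concatMap; allFin; cartesianProduct)
import Data.List.Properties as List
open import Data.Nat as ℕ using (ℕ; zero; suc; _∸_; _≤ᵇ_; _≡ᵇ_; _≤_; _<_; z≤n; s≤s)
import Data.Nat.Properties as ℕ
open import Data.Product using (_×_; _,_; proj₁; proj₂)
open import Data.Rational using (ℚ; 0ℚ; 1ℚ; _+_; _*_; _-_; toℚᵘ; fromℚᵘ) renaming (_≤_ to _≤ℚ_)
open import Data.Rational.Properties
import Data.Rational.Solver as ℚSolver
import Data.Rational.Unnormalised as ℚᵘ
import Data.Rational.Unnormalised.Properties as ℚᵘ
open import Data.Sum using (_⊎_; inj₁; inj₂)
import Data.Sum as Sum
open import Data.Vec as V using (Vec; []; _∷_; lookup; _[_]≔_)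
import Data.Vec.Properties as Vec
open import Function using (_∘_; Equivalence)
open import Relation.Binary.PropositionalEquality hiding ([_])
open import Relation.Nullary using (¬_; yes; no)

open import Algebra.Properties.CommutativeSemigroup
  (CommutativeMonoid.commutativeSemigroup +-0-commutativeMonoid) using (interchange; xy∙z≈yz∙x)
import Algebra.Properties.CommutativeSemigroup ℕ.+-commutativeSemigroup as ℕ+

private variable
  A B : Set

∑ : List A → (A → ℚ) → ℚ
∑ xs g = sumℚ (map g xs)

∑-cong : (xs : List A) {g h : A → ℚ} → (∀ x → g x ≡ h x) → ∑ xs g ≡ ∑ xs h
∑-cong []       eq = refl
∑-cong (x ∷ xs) eq = cong₂ _+_ (eq x) (∑-cong xs eq)

∑-zero : (xs : List A) → ∑ xs (λ _ → 0ℚ) ≡ 0ℚ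
∑-zero []       = refl
∑-zero (x ∷ xs) = trans (+-identityˡ _) (∑-zero xs)

∑-distrib-+ : (xs : List A) (g h : A → ℚ) → ∑ xs (λ x → g x + h x) ≡ ∑ xs g + ∑ xs h
∑-distrib-+ []       g h = sym (+-identityˡ 0ℚ)
∑-distrib-+ (x ∷ xs) g h = begin
  (g x + h x) + ∑ xs (λ x → g x + h x) ≡⟨ cong ((g x + h x) +_) (∑-distrib-+ xs g h) ⟩
  (g x + h x) + (∑ xs g + ∑ xs h)      ≡⟨ interchange (g x) (h x) _ _ ⟩
  (g x + ∑ xs g) + (h x + ∑ xs h)      ∎
  where open ≡-Reasoning

∑-distribˡ-* : (xs : List A) (c : ℚ) (g : A → ℚ) → ∑ xs (λ x → c * g x) ≡ c * ∑ xs g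
∑-distribˡ-* []       c g = sym (*-zeroʳ c)
∑-distribˡ-* (x ∷ xs) c g =
  trans (cong (c * g x +_) (∑-distribˡ-* xs c g)) (sym (*-distribˡ-+ c (g x) (∑ xs g)))

∑-++ : (xs ys : List A) (g : A → ℚ) → ∑ (xs ++ ys) g ≡ ∑ xs g + ∑ ys g
∑-++ []       ys g = sym (+-identityˡ _)
∑-++ (x ∷ xs) ys g = trans (cong (g x +_) (∑-++ xs ys g)) (sym (+-assoc (g x) _ _))

∑-filterᵇ : (b : A → Bool) (xs : List A) (g : A → ℚ) →
            ∑ (filterᵇ b xs) g ≡ ∑ xs (λ x → [ b x ]· g x)
∑-filterᵇ b []       g = refl
∑-filterᵇ b (x ∷ xs) g with b x
... | true  = cong (g x +_) (∑-filterᵇ b xs g)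
... | false = trans (∑-filterᵇ b xs g) (sym (+-identityˡ _))

∑-filterᵇ-cong : (b : A → Bool) (xs : List A) {g h : A → ℚ} → (∀ x → b x ≡ true → g x ≡ h x) →
                 ∑ (filterᵇ b xs) g ≡ ∑ (filterᵇ b xs) h
∑-filterᵇ-cong b []       eq = refl
∑-filterᵇ-cong b (x ∷ xs) eq with b x in bx
... | true  = cong₂ _+_ (eq x bx) (∑-filterᵇ-cong b xs eq)
... | false = ∑-filterᵇ-cong b xs eq

∑-indicator : (xs : List A) (b : Bool) (g : A → ℚ) → ∑ xs (λ x → [ b ]· g x) ≡ [ b ]· ∑ xs g
∑-indicator xs true  g = refl
∑-indicator xs false g = ∑-zero xs

∑-map : (xs : List A) (h : A → B) (g : B → ℚ) → ∑ (map h xs) g ≡ ∑ xs (λ x → g (h x))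
∑-map []       h g = refl
∑-map (x ∷ xs) h g = cong (g (h x) +_) (∑-map xs h g)

∑-concatMap : (xs : List A) (F : A → List B) (g : B → ℚ) →
              ∑ (concatMap F xs) g ≡ ∑ xs (λ x → ∑ (F x) g)
∑-concatMap []       F g = refl
∑-concatMap (x ∷ xs) F g =
  trans (∑-++ (F x) (concatMap F xs) g) (cong (∑ (F x) g +_) (∑-concatMap xs F g))

∑-comm : (xs : List A) (ys : List B) (h : A → B → ℚ) →
         ∑ xs (λ x → ∑ ys (h x)) ≡ ∑ ys (λ y → ∑ xs (λ x → h x y))
∑-comm []       ys h = sym (∑-zero ys)
∑-comm (x ∷ xs) ys h = trans (cong (∑ ys (h x) +_) (∑-comm xs ys h))
                             (sym (∑-distrib-+ ys (h x) (λ y → ∑ xs (λ x → h x y))))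

∑-cartesianProduct : (xs : List A) (ys : List B) (h : A × B → ℚ) →
                     ∑ (cartesianProduct xs ys) h ≡ ∑ xs (λ x → ∑ ys (λ y → h (x , y)))
∑-cartesianProduct []       ys h = refl
∑-cartesianProduct (x ∷ xs) ys h = trans (∑-++ (map (x ,_) ys) _ h)
  (cong₂ _+_ (∑-map ys (x ,_) h) (∑-cartesianProduct xs ys h))

∑-allFin-suc : ∀ n (g : Fin (suc n) → ℚ) → ∑ (allFin (suc n)) g ≡ g zero + ∑ (allFin n) (λ k → g (suc k))
∑-allFin-suc n g = cong (g zero +_) (begin
  sumℚ (map g (L.tabulate suc))           ≡⟨ cong sumℚ (List.map-tabulate suc g) ⟩
  sumℚ (L.tabulate (λ k → g (suc k)))     ≡⟨ cong sumℚ (List.map-tabulate (λ k → k) (λ k → g (suc k))) ⟨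
  sumℚ (map (λ k → g (suc k)) (allFin n)) ∎)
  where open ≡-Reasoning

[]·-∧ : ∀ a b x → [ a ∧ b ]· x ≡ [ a ]· ([ b ]· x)
[]·-∧ true  b x = refl
[]·-∧ false b x = refl

[]·-comm : ∀ a b x → [ a ]· ([ b ]· x) ≡ [ b ]· ([ a ]· x)
[]·-comm true  b     x = refl
[]·-comm false true  x = refl
[]·-comm false false x = refl

[]·-zero : ∀ a → [ a ]· 0ℚ ≡ 0ℚ
[]·-zero true  = refl
[]·-zero false = refl

[]·-distrib-+ : ∀ a x y → [ a ]· (x + y) ≡ [ a ]· x + [ a ]· y
[]·-distrib-+ true  x y = refl
[]·-distrib-+ false x y = sym (+-identityˡ 0ℚ)

[]·-*-comm : ∀ a c x → [ a ]· (c * x) ≡ c * ([ a ]· x)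
[]·-*-comm true  c x = refl
[]·-*-comm false c x = sym (*-zeroʳ c)

[]·-float₃ : ∀ a b c d r → [ a ]· ([ b ]· ([ c ]· ([ d ]· r))) ≡ [ d ]· ([ a ]· ([ b ]· ([ c ]· r)))
[]·-float₃ a b c d r = begin
  [ a ]· ([ b ]· ([ c ]· ([ d ]· r))) ≡⟨ cong (λ s → [ a ]· ([ b ]· s)) ([]·-comm c d r) ⟩
  [ a ]· ([ b ]· ([ d ]· ([ c ]· r))) ≡⟨ cong ([ a ]·_) ([]·-comm b d _) ⟩
  [ a ]· ([ d ]· ([ b ]· ([ c ]· r))) ≡⟨ []·-comm a d _ ⟩
  [ d ]· ([ a ]· ([ b ]· ([ c ]· r))) ∎
  where open ≡-Reasoning

[]·-if : ∀ c b x y → (b ≡ true → c ≡ true) → [ c ]· (if b then x else y) ≡ [ b ]· x + [ c ]· ([ not b ]· y)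
[]·-if c true  x y b⇒c rewrite b⇒c refl = sym (+-identityʳ x)
[]·-if c false x y _   = sym (+-identityˡ _)

[]·-split : ∀ a b c x → (b ≡ false → c ≡ true) →
            [ a ]· ([ b ]· x) ≡ [ a ∧ c ]· ([ b ]· x) + [ a ]· ([ not c ]· x)
[]·-split false b     c     x _   = sym (+-identityˡ 0ℚ)
[]·-split true  true  true  x _   = sym (+-identityʳ x)
[]·-split true  true  false x _   = sym (+-identityˡ x)
[]·-split true  false c     x ¬b⇒c rewrite ¬b⇒c refl = sym (+-identityˡ 0ℚ)

[]·-0+0 : ∀ a → [ a ]· (0ℚ + 0ℚ) ≡ 0ℚ
[]·-0+0 a = trans (cong ([ a ]·_) (+-identityˡ 0ℚ)) ([]·-zero a)

∧-true : ∀ {a b} → (a ∧ b) ≡ true → a ≡ true × b ≡ true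
∧-true {true} {true} _ = refl , refl

not-false⇒true : ∀ {b} → not b ≡ false → b ≡ true
not-false⇒true {true} _ = refl

≡⇒≡ᵇ-true : ∀ {x y} → x ≡ y → (x ≡ᵇ y) ≡ true
≡⇒≡ᵇ-true {x} {y} = Equivalence.to T-≡ ∘ ℕ.≡⇒≡ᵇ x y

≡ᵇ-true⇒≡ : ∀ {x y} → (x ≡ᵇ y) ≡ true → x ≡ y
≡ᵇ-true⇒≡ {x} {y} = ℕ.≡ᵇ⇒≡ x y ∘ Equivalence.from T-≡

≢⇒≡ᵇ-false : ∀ {x y} → x ≢ y → (x ≡ᵇ y) ≡ false
≢⇒≡ᵇ-false x≢y = ¬-not (x≢y ∘ ≡ᵇ-true⇒≡)

≤⇒≤ᵇ-true : ∀ {x y} → x ≤ y → (x ≤ᵇ y) ≡ true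
≤⇒≤ᵇ-true = Equivalence.to T-≡ ∘ ℕ.≤⇒≤ᵇ

≤ᵇ-true⇒≤ : ∀ {x y} → (x ≤ᵇ y) ≡ true → x ≤ y
≤ᵇ-true⇒≤ {x} {y} = ℕ.≤ᵇ⇒≤ x y ∘ Equivalence.from T-≡

≰⇒≤ᵇ-false : ∀ {x y} → ¬ x ≤ y → (x ≤ᵇ y) ≡ false
≰⇒≤ᵇ-false x≰y = ¬-not (x≰y ∘ ≤ᵇ-true⇒≤)

≤ᵇ-false⇒> : ∀ {x y} → (x ≤ᵇ y) ≡ false → y < x
≤ᵇ-false⇒> x≰ᵇy = ℕ.≰⇒> (not-¬ x≰ᵇy ∘ ≤⇒≤ᵇ-true)

≡ᵇ-sym : ∀ x y → (x ≡ᵇ y) ≡ (y ≡ᵇ x)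
≡ᵇ-sym zero    zero    = refl
≡ᵇ-sym zero    (suc y) = refl
≡ᵇ-sym (suc x) zero    = refl
≡ᵇ-sym (suc x) (suc y) = ≡ᵇ-sym x y

==v-refl : ∀ {n} → (v : Vec ℕ n) → (v ==v v) ≡ true
==v-refl []      = refl
==v-refl (x ∷ v) rewrite ≡⇒≡ᵇ-true (refl {x = x}) = ==v-refl v

==v-true⇒≡ : ∀ {n} {a b : Vec ℕ n} → (a ==v b) ≡ true → a ≡ b
==v-true⇒≡ {a = []}    {[]}    _  = refl
==v-true⇒≡ {a = x ∷ a} {y ∷ b} eq with ∧-true {x ≡ᵇ y} eq
... | x≡y , a≡b = cong₂ _∷_ (≡ᵇ-true⇒≡ x≡y) (==v-true⇒≡ a≡b)

≢⇒==v-false : ∀ {n} {a b : Vec ℕ n} → a ≢ b → (a ==v b) ≡ false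
≢⇒==v-false a≢b = ¬-not (a≢b ∘ ==v-true⇒≡)

==v-sym : ∀ {n} → (a b : Vec ℕ n) → (a ==v b) ≡ (b ==v a)
==v-sym []      []      = refl
==v-sym (x ∷ a) (y ∷ b) = cong₂ _∧_ (≡ᵇ-sym x y) (==v-sym a b)

==Ω-refl : ∀ {n} → (y : Vec ℕ n × Vec ℕ n) → (y ==Ω y) ≡ true
==Ω-refl (w , l) rewrite ==v-refl w | ==v-refl l = refl

==Ω-true⇒≡ : ∀ {n} {y z : Vec ℕ n × Vec ℕ n} → (y ==Ω z) ≡ true → y ≡ z
==Ω-true⇒≡ {y = w , l} {w′ , l′} eq with ∧-true {w ==v w′} eq
... | w≡w′ , l≡l′ = cong₂ _,_ (==v-true⇒≡ w≡w′) (==v-true⇒≡ l≡l′)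

==Ω-sym : ∀ {n} → (y z : Vec ℕ n × Vec ℕ n) → (y ==Ω z) ≡ (z ==Ω y)
==Ω-sym (w , l) (w′ , l′) = cong₂ _∧_ (==v-sym w w′) (==v-sym l l′)

range : ℕ → ℕ → List ℕ
range s zero    = []
range s (suc m) = s ∷ range (suc s) m

applyUpTo≡range : ∀ m s (f : ℕ → ℕ) → (∀ i → f i ≡ s ℕ.+ i) → L.applyUpTo f m ≡ range s m
applyUpTo≡range zero    s f f≗s+ = refl
applyUpTo≡range (suc m) s f f≗s+ = cong₂ _∷_ (trans (f≗s+ 0) (ℕ.+-identityʳ s))
  (applyUpTo≡range m (suc s) (f ∘ suc) (λ i → trans (f≗s+ (suc i)) (ℕ.+-suc s i)))

upTo≡range : ∀ m → upTo m ≡ range 0 m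
upTo≡range m = applyUpTo≡range m 0 (λ i → i) (λ i → refl)

∑-range-miss : ∀ m s x (k : ℕ → ℚ) → x < s ⊎ s ℕ.+ m ≤ x →
               ∑ (range s m) (λ a → [ x ≡ᵇ a ]· k a) ≡ 0ℚ
∑-range-miss zero    s x k _   = refl
∑-range-miss (suc m) s x k out = begin
  [ x ≡ᵇ s ]· k s + ∑ (range (suc s) m) (λ a → [ x ≡ᵇ a ]· k a)
    ≡⟨ cong₂ _+_ (cong (λ b → [ b ]· k s) (≢⇒≡ᵇ-false x≢s)) (∑-range-miss m (suc s) x k out′) ⟩
  0ℚ + 0ℚ
    ≡⟨ +-identityˡ 0ℚ ⟩
  0ℚ ∎
  where
  open ≡-Reasoning
  x≢s : x ≢ s
  x≢s = Sum.[ ℕ.<⇒≢ , (λ s+1+m≤x x≡s → ℕ.m+1+n≰m s (subst (s ℕ.+ suc m ≤_) x≡s s+1+m≤x)) ] out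
  out′ : x < suc s ⊎ suc s ℕ.+ m ≤ x
  out′ = Sum.map ℕ.m<n⇒m<1+n (subst (_≤ x) (ℕ.+-suc s m)) out

∑-range-hit : ∀ m s x (k : ℕ → ℚ) → s ≤ x → x < s ℕ.+ m →
              ∑ (range s m) (λ a → [ x ≡ᵇ a ]· k a) ≡ k x
∑-range-hit zero    s x k s≤x x<s+0 =
  ⊥-elim (ℕ.<-irrefl refl (ℕ.≤-<-trans s≤x (subst (x <_) (ℕ.+-identityʳ s) x<s+0)))
∑-range-hit (suc m) s x k s≤x x<s+m with x ℕ.≟ s
... | yes refl rewrite ≡⇒≡ᵇ-true (refl {x = x}) =
  trans (cong (k x +_) (∑-range-miss m (suc x) x k (inj₁ (ℕ.n<1+n x)))) (+-identityʳ (k x))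
... | no x≢s rewrite ≢⇒≡ᵇ-false x≢s =
  trans (+-identityˡ _)
        (∑-range-hit m (suc s) x k (ℕ.≤∧≢⇒< s≤x (x≢s ∘ sym)) (subst (x <_) (ℕ.+-suc s m) x<s+m))

∑-range-cong : ∀ m s {g h : ℕ → ℚ} → (∀ i → s ≤ i → i < s ℕ.+ m → g i ≡ h i) →
               ∑ (range s m) g ≡ ∑ (range s m) h
∑-range-cong zero    s eq = refl
∑-range-cong (suc m) s eq = cong₂ _+_ (eq s ℕ.≤-refl (ℕ.m<m+n s (s≤s z≤n)))
  (∑-range-cong m (suc s) (λ i s<i i<s+m → eq i (ℕ.<⇒≤ s<i) (subst (i <_) (sym (ℕ.+-suc s m)) i<s+m)))

∑-allVecs-point : ∀ n p (g : Vec ℕ n) (h : Vec ℕ n → ℚ) →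
                  ∑ (allVecs n p) (λ x → [ g ==v x ]· h x) ≡ [ allLe p g ]· h g
∑-allVecs-point zero    p []       h = +-identityʳ (h [])
∑-allVecs-point (suc n) p (g₀ ∷ g) h = begin
  ∑ (allVecs (suc n) p) (λ x → [ (g₀ ∷ g) ==v x ]· h x)
    ≡⟨ ∑-concatMap (upTo (suc p)) (λ a → map (a ∷_) (allVecs n p)) _ ⟩
  ∑ (upTo (suc p)) (λ a → ∑ (map (a ∷_) (allVecs n p)) (λ x → [ (g₀ ∷ g) ==v x ]· h x))
    ≡⟨ ∑-cong (upTo (suc p)) column ⟩
  ∑ (upTo (suc p)) (λ a → [ g₀ ≡ᵇ a ]· k a)
    ≡⟨ cong (λ as → ∑ as (λ a → [ g₀ ≡ᵇ a ]· k a)) (upTo≡range (suc p)) ⟩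
  ∑ (range 0 (suc p)) (λ a → [ g₀ ≡ᵇ a ]· k a)
    ≡⟨ pick ⟩
  [ (g₀ ≤ᵇ p) ∧ allLe p g ]· h (g₀ ∷ g) ∎
  where
  open ≡-Reasoning
  k : ℕ → ℚ
  k a = [ allLe p g ]· h (a ∷ g)
  column : ∀ a → ∑ (map (a ∷_) (allVecs n p)) (λ x → [ (g₀ ∷ g) ==v x ]· h x) ≡ [ g₀ ≡ᵇ a ]· k a
  column a = begin
    ∑ (map (a ∷_) (allVecs n p)) (λ x → [ (g₀ ∷ g) ==v x ]· h x)
      ≡⟨ ∑-map (allVecs n p) (a ∷_) _ ⟩
    ∑ (allVecs n p) (λ x → [ (g₀ ≡ᵇ a) ∧ (g ==v x) ]· h (a ∷ x))
      ≡⟨ ∑-cong (allVecs n p) (λ x → []·-∧ (g₀ ≡ᵇ a) (g ==v x) (h (a ∷ x))) ⟩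
    ∑ (allVecs n p) (λ x → [ g₀ ≡ᵇ a ]· ([ g ==v x ]· h (a ∷ x)))
      ≡⟨ ∑-indicator (allVecs n p) (g₀ ≡ᵇ a) _ ⟩
    [ g₀ ≡ᵇ a ]· ∑ (allVecs n p) (λ x → [ g ==v x ]· h (a ∷ x))
      ≡⟨ cong ([ g₀ ≡ᵇ a ]·_) (∑-allVecs-point n p g (λ x → h (a ∷ x))) ⟩
    [ g₀ ≡ᵇ a ]· k a ∎
  pick : ∑ (range 0 (suc p)) (λ a → [ g₀ ≡ᵇ a ]· k a) ≡ [ (g₀ ≤ᵇ p) ∧ allLe p g ]· h (g₀ ∷ g)
  pick with g₀ ℕ.≤? p
  ... | yes g₀≤p rewrite ≤⇒≤ᵇ-true g₀≤p = ∑-range-hit (suc p) 0 g₀ k z≤n (s≤s g₀≤p)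
  ... | no  g₀≰p rewrite ≰⇒≤ᵇ-false g₀≰p = ∑-range-miss (suc p) 0 g₀ k (inj₂ (ℕ.≰⇒> g₀≰p))

∑-allVecs²-point : ∀ n p (y : Vec ℕ n × Vec ℕ n) (h : Vec ℕ n × Vec ℕ n → ℚ) →
  ∑ (cartesianProduct (allVecs n 1) (allVecs n p)) (λ z → [ y ==Ω z ]· h z)
    ≡ [ allLe 1 (proj₁ y) ]· ([ allLe p (proj₂ y) ]· h y)
∑-allVecs²-point n p (w , l) h = begin
  ∑ (cartesianProduct (allVecs n 1) (allVecs n p)) (λ z → [ (w , l) ==Ω z ]· h z)
    ≡⟨ ∑-cartesianProduct (allVecs n 1) (allVecs n p) _ ⟩
  ∑ (allVecs n 1) (λ w′ → ∑ (allVecs n p) (λ l′ → [ (w ==v w′) ∧ (l ==v l′) ]· h (w′ , l′)))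
    ≡⟨ ∑-cong (allVecs n 1) row ⟩
  ∑ (allVecs n 1) (λ w′ → [ w ==v w′ ]· ([ allLe p l ]· h (w′ , l)))
    ≡⟨ ∑-allVecs-point n 1 w (λ w′ → [ allLe p l ]· h (w′ , l)) ⟩
  [ allLe 1 w ]· ([ allLe p l ]· h (w , l)) ∎
  where
  open ≡-Reasoning
  row : ∀ w′ → ∑ (allVecs n p) (λ l′ → [ (w ==v w′) ∧ (l ==v l′) ]· h (w′ , l′))
             ≡ [ w ==v w′ ]· ([ allLe p l ]· h (w′ , l))
  row w′ = begin
    ∑ (allVecs n p) (λ l′ → [ (w ==v w′) ∧ (l ==v l′) ]· h (w′ , l′))
      ≡⟨ ∑-cong (allVecs n p) (λ l′ → []·-∧ (w ==v w′) (l ==v l′) _) ⟩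
    ∑ (allVecs n p) (λ l′ → [ w ==v w′ ]· ([ l ==v l′ ]· h (w′ , l′)))
      ≡⟨ ∑-indicator (allVecs n p) (w ==v w′) _ ⟩
    [ w ==v w′ ]· ∑ (allVecs n p) (λ l′ → [ l ==v l′ ]· h (w′ , l′))
      ≡⟨ cong ([ w ==v w′ ]·_) (∑-allVecs-point n p l (λ l′ → h (w′ , l′))) ⟩
    [ w ==v w′ ]· ([ allLe p l ]· h (w′ , l)) ∎

count : ∀ {n} → (ℕ → ℕ) → Vec ℕ n → ℕ
count g []       = 0
count g (x ∷ xs) = g x ℕ.+ count g xs

δ : ℕ → ℕ → ℕ
δ i x = if x ≡ᵇ i then 1 else 0

sgn : ℕ → ℕ
sgn x = if x ≡ᵇ 0 then 0 else 1

sgn-suc : ∀ x → 1 ≤ x → sgn (suc x) ≡ sgn x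
sgn-suc (suc x) _ = refl

sgn-pred : ∀ x → 2 ≤ x → sgn (x ∸ 1) ≡ sgn x
sgn-pred (suc (suc x)) _         = refl
sgn-pred (suc zero)    (s≤s ())

ℕtoℚ-suc : ∀ m → ℕtoℚ (suc m) ≡ 1ℚ + ℕtoℚ m
ℕtoℚ-suc m = sym (trans (sym (fromℚᵘ-toℚᵘ (1ℚ + ℕtoℚ m))) (fromℚᵘ-cong (begin
  toℚᵘ (1ℚ + ℕtoℚ m)                               ≈⟨ toℚᵘ-homo-+ 1ℚ (ℕtoℚ m) ⟩
  toℚᵘ 1ℚ ℚᵘ.+ toℚᵘ (ℕtoℚ m)                        ≈⟨ ℚᵘ.+-congʳ (toℚᵘ 1ℚ) (toℚᵘ-fromℚᵘ (ℚᵘ.mkℚᵘ (ℤ.+ m) 0)) ⟩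
  ℚᵘ.mkℚᵘ (ℤ.+ 1) 0 ℚᵘ.+ ℚᵘ.mkℚᵘ (ℤ.+ m) 0        ≈⟨ ℚᵘ.*≡* (cong (λ z → (ℤ.+ 1 ℤ.+ z) ℤ.* ℤ.+ 1) (ℤ.*-identityʳ (ℤ.+ m))) ⟩
  ℚᵘ.mkℚᵘ (ℤ.+ suc m) 0                            ∎)))
  where open ℚᵘ.≃-Reasoning

ℕtoℚ-δ+ : ∀ i x m (c : ℚ) → ℕtoℚ (δ i x ℕ.+ m) * c ≡ [ x ≡ᵇ i ]· c + ℕtoℚ m * c
ℕtoℚ-δ+ i x m c with x ≡ᵇ i
... | true  = trans (cong (_* c) (ℕtoℚ-suc m))
                    (trans (*-distribʳ-+ c 1ℚ (ℕtoℚ m)) (cong (_+ ℕtoℚ m * c) (*-identityˡ c)))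
... | false = sym (+-identityˡ _)

∑-lookup≡∑-mult : ∀ {n} p (v : Vec ℕ n) (G : ℕ → ℚ) → G 0 ≡ 0ℚ → allLe p v ≡ true →
                  ∑ (allFin n) (λ k → G (lookup v k)) ≡ ∑ (range 1 p) (λ i → ℕtoℚ (mult i v) * G i)
∑-lookup≡∑-mult p []      G G0≡0 _ =
  sym (trans (∑-cong (range 1 p) (λ i → *-zeroˡ (G i))) (∑-zero (range 1 p)))
∑-lookup≡∑-mult {suc n} p (x ∷ v) G G0≡0 x∷v≤p with ∧-true {x ≤ᵇ p} x∷v≤p
... | x≤p , v≤p = begin
  ∑ (allFin (suc n)) (λ k → G (lookup (x ∷ v) k))
    ≡⟨ ∑-allFin-suc n (λ k → G (lookup (x ∷ v) k)) ⟩
  G x + ∑ (allFin n) (λ k → G (lookup v k))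
    ≡⟨ cong₂ _+_ (sym (valueOf x x≤p)) (∑-lookup≡∑-mult p v G G0≡0 v≤p) ⟩
  ∑ (range 1 p) (λ i → [ x ≡ᵇ i ]· G i) + ∑ (range 1 p) (λ i → ℕtoℚ (mult i v) * G i)
    ≡⟨ ∑-distrib-+ (range 1 p) _ _ ⟨
  ∑ (range 1 p) (λ i → [ x ≡ᵇ i ]· G i + ℕtoℚ (mult i v) * G i)
    ≡⟨ ∑-cong (range 1 p) (λ i → sym (ℕtoℚ-δ+ i x (mult i v) (G i))) ⟩
  ∑ (range 1 p) (λ i → ℕtoℚ (mult i (x ∷ v)) * G i) ∎
  where
  open ≡-Reasoning
  valueOf : ∀ x → (x ≤ᵇ p) ≡ true → ∑ (range 1 p) (λ i → [ x ≡ᵇ i ]· G i) ≡ G x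
  valueOf zero    _   = trans (∑-range-miss p 1 0 G (inj₁ (s≤s z≤n))) (sym G0≡0)
  valueOf (suc x) x≤p = ∑-range-hit p 1 (suc x) G (s≤s z≤n) (s≤s (≤ᵇ-true⇒≤ x≤p))

mult≡count : ∀ {n} i (v : Vec ℕ n) → mult i v ≡ count (δ i) v
mult≡count i []      = refl
mult≡count i (x ∷ v) = cong (δ i x ℕ.+_) (mult≡count i v)

nonzeros≡count : ∀ {n} (v : Vec ℕ n) → nonzeros v ≡ count sgn v
nonzeros≡count []      = refl
nonzeros≡count (x ∷ v) = cong (sgn x ℕ.+_) (nonzeros≡count v)

-- Multiset equality, encoded as equality of every additive statistic.
record SameMultiset {n} (a b : Vec ℕ n) : Set where
  constructor sameMultiset
  field count-≡ : ∀ g → count g a ≡ count g b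
open SameMultiset

mult-cong : ∀ {n} {a b : Vec ℕ n} → SameMultiset a b → ∀ i → mult i a ≡ mult i b
mult-cong {a = a} {b} a∼b i = trans (mult≡count i a) (trans (count-≡ a∼b (δ i)) (sym (mult≡count i b)))

nonzeros-cong : ∀ {n} {a b : Vec ℕ n} → SameMultiset a b → nonzeros a ≡ nonzeros b
nonzeros-cong {a = a} {b} a∼b = trans (nonzeros≡count a) (trans (count-≡ a∼b sgn) (sym (nonzeros≡count b)))

count-insertDesc : ∀ {n} g x (v : Vec ℕ n) → count g (insertDesc x v) ≡ g x ℕ.+ count g v
count-insertDesc g x []      = refl
count-insertDesc g x (y ∷ v) with y ≤ᵇ x
... | true  = refl
... | false = trans (cong (g y ℕ.+_) (count-insertDesc g x v)) (ℕ+.x∙yz≈y∙xz (g y) (g x) _)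

sortDesc-sameMultiset : ∀ {n} (v : Vec ℕ n) → SameMultiset (sortDesc v) v
sortDesc-sameMultiset []      = sameMultiset λ _ → refl
sortDesc-sameMultiset (x ∷ v) = sameMultiset λ g →
  trans (count-insertDesc g x (sortDesc v)) (cong (g x ℕ.+_) (count-≡ (sortDesc-sameMultiset v) g))

count-[]≔ : ∀ {n} g (v : Vec ℕ n) k x → count g (v [ k ]≔ x) ℕ.+ g (lookup v k) ≡ count g v ℕ.+ g x
count-[]≔ g (y ∷ v) zero    x = ℕ+.xy∙z≈zy∙x (g x) (count g v) (g y)
count-[]≔ g (y ∷ v) (suc k) x =
  trans (ℕ.+-assoc (g y) _ _) (trans (cong (g y ℕ.+_) (count-[]≔ g v k x)) (sym (ℕ.+-assoc (g y) _ _)))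

count-replaceFirst : ∀ {n} g i x (v : Vec ℕ n) → 1 ≤ mult i v →
                     count g (replaceFirst i x v) ℕ.+ g i ≡ count g v ℕ.+ g x
count-replaceFirst g i x (y ∷ v) i∈v with y ≡ᵇ i in y≡ᵇi
... | true = trans (ℕ+.xy∙z≈zy∙x (g x) (count g v) (g i))
  (cong (λ z → g z ℕ.+ count g v ℕ.+ g x) (sym (≡ᵇ-true⇒≡ y≡ᵇi)))
... | false = trans (ℕ.+-assoc (g y) _ _)
  (trans (cong (g y ℕ.+_) (count-replaceFirst g i x v i∈v)) (sym (ℕ.+-assoc (g y) _ _)))

lookup-[]≔-lookup : ∀ {n} (v : Vec ℕ n) i j → lookup (v [ i ]≔ lookup v j) j ≡ lookup v j
lookup-[]≔-lookup v i j with i Fin.≟ j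
... | yes refl = Vec.lookup∘update i v (lookup v i)
... | no  i≢j  = Vec.lookup∘update′ (i≢j ∘ sym) v (lookup v j)

swapAt-sameMultiset : ∀ {n} k (v : Vec ℕ n) → SameMultiset (swapAt k v) v
swapAt-sameMultiset k v = sameMultiset λ g → ℕ.+-cancelʳ-≡ (g b) _ _ (begin
  count g (swapAt k v) ℕ.+ g b
    ≡⟨ cong (λ z → count g (swapAt k v) ℕ.+ g z) (lookup-[]≔-lookup v k (next k)) ⟨
  count g (swapAt k v) ℕ.+ g (lookup (v [ k ]≔ b) (next k))
    ≡⟨ count-[]≔ g (v [ k ]≔ b) (next k) (lookup v k) ⟩
  count g (v [ k ]≔ b) ℕ.+ g (lookup v k)
    ≡⟨ count-[]≔ g v k b ⟩
  count g v ℕ.+ g b ∎)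
  where
  open ≡-Reasoning
  b = lookup v (next k)

mult-changePart-target : ∀ {n} i j (v : Vec ℕ n) → 1 ≤ mult i v → i ≢ j →
                         mult j (changePart i j v) ≡ suc (mult j v)
mult-changePart-target i j v i∈v i≢j = begin
  mult j (changePart i j v)             ≡⟨ mult-cong (sortDesc-sameMultiset (replaceFirst i j v)) j ⟩
  mult j (replaceFirst i j v)           ≡⟨ mult≡count j (replaceFirst i j v) ⟩
  count (δ j) (replaceFirst i j v)      ≡⟨ ℕ.+-identityʳ _ ⟨
  count (δ j) (replaceFirst i j v) ℕ.+ 0 ≡⟨ cong (λ b → count (δ j) (replaceFirst i j v) ℕ.+ (if b then 1 else 0))
                                               (sym (≢⇒≡ᵇ-false i≢j)) ⟩
  count (δ j) (replaceFirst i j v) ℕ.+ δ j i ≡⟨ count-replaceFirst (δ j) i j v i∈v ⟩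
  count (δ j) v ℕ.+ δ j j               ≡⟨ cong (λ b → count (δ j) v ℕ.+ (if b then 1 else 0)) (≡⇒≡ᵇ-true (refl {x = j})) ⟩
  count (δ j) v ℕ.+ 1                   ≡⟨ ℕ.+-comm _ 1 ⟩
  suc (count (δ j) v)                   ≡⟨ cong suc (mult≡count j v) ⟨
  suc (mult j v)                        ∎
  where open ≡-Reasoning

headLe : ∀ {n} → ℕ → Vec ℕ n → Bool
headLe y []      = true
headLe y (z ∷ _) = z ≤ᵇ y

isDecr-∷ : ∀ {n} y (v : Vec ℕ n) → headLe y v ≡ true → isDecr v ≡ true → isDecr (y ∷ v) ≡ true
isDecr-∷ y []      _  _  = refl
isDecr-∷ y (z ∷ v) z≤y dv rewrite z≤y = dv

isDecr-tail : ∀ {n} x (v : Vec ℕ n) → isDecr (x ∷ v) ≡ true → isDecr v ≡ true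
isDecr-tail x []      _ = refl
isDecr-tail x (y ∷ v) d = proj₂ (∧-true {y ≤ᵇ x} d)

isDecr-headLe : ∀ {n} x (v : Vec ℕ n) → isDecr (x ∷ v) ≡ true → headLe x v ≡ true
isDecr-headLe x []      _ = refl
isDecr-headLe x (y ∷ v) d = proj₁ (∧-true {y ≤ᵇ x} d)

headLe-insertDesc : ∀ {n} x y (v : Vec ℕ n) → x ≤ y → headLe y v ≡ true → headLe y (insertDesc x v) ≡ true
headLe-insertDesc x y []      x≤y _  = ≤⇒≤ᵇ-true x≤y
headLe-insertDesc x y (z ∷ v) x≤y hv with z ≤ᵇ x
... | true  = ≤⇒≤ᵇ-true x≤y
... | false = hv

isDecr-insertDesc : ∀ {n} x (v : Vec ℕ n) → isDecr v ≡ true → isDecr (insertDesc x v) ≡ true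
isDecr-insertDesc x []      _  = refl
isDecr-insertDesc x (y ∷ v) dv with y ≤ᵇ x in y≤ᵇx
... | true  rewrite y≤ᵇx = dv
... | false = isDecr-∷ y (insertDesc x v)
  (headLe-insertDesc x y v (ℕ.<⇒≤ (≤ᵇ-false⇒> y≤ᵇx)) (isDecr-headLe y v dv))
  (isDecr-insertDesc x v (isDecr-tail y v dv))

isDecr-sortDesc : ∀ {n} (v : Vec ℕ n) → isDecr (sortDesc v) ≡ true
isDecr-sortDesc []      = refl
isDecr-sortDesc (x ∷ v) = isDecr-insertDesc x (sortDesc v) (isDecr-sortDesc v)

mult-∷-self : ∀ {n} x (v : Vec ℕ n) → 1 ≤ mult x (x ∷ v)
mult-∷-self x v rewrite ≡⇒≡ᵇ-true (refl {x = x}) = s≤s z≤n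

isDecr-head-max : ∀ {n} x (v : Vec ℕ n) j → isDecr (x ∷ v) ≡ true → 1 ≤ mult j (x ∷ v) → j ≤ x
isDecr-head-max x v j d j∈xv with x ≡ᵇ j in x≡ᵇj
... | true = ℕ.≤-reflexive (sym (≡ᵇ-true⇒≡ x≡ᵇj))
isDecr-head-max x (y ∷ v) j d j∈v | false =
  ℕ.≤-trans (isDecr-head-max y v j (isDecr-tail x (y ∷ v) d) j∈v)
            (≤ᵇ-true⇒≤ (isDecr-headLe x (y ∷ v) d))

isDecr-sameMultiset⇒≡ : ∀ {n} (a b : Vec ℕ n) → isDecr a ≡ true → isDecr b ≡ true →
                         SameMultiset a b → a ≡ b
isDecr-sameMultiset⇒≡ []      []      _  _  _   = refl
isDecr-sameMultiset⇒≡ (x ∷ a) (y ∷ b) da db a∼b =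
  cong₂ _∷_ x≡y (isDecr-sameMultiset⇒≡ a b (isDecr-tail x a da) (isDecr-tail y b db) tails)
  where
  x≡y : x ≡ y
  x≡y = ℕ.≤-antisym
    (isDecr-head-max y b x db (subst (1 ≤_) (mult-cong a∼b x) (mult-∷-self x a)))
    (isDecr-head-max x a y da (subst (1 ≤_) (sym (mult-cong a∼b y)) (mult-∷-self y b)))
  tails : SameMultiset a b
  tails = sameMultiset λ g →
    ℕ.+-cancelˡ-≡ (g x) _ _ (trans (count-≡ a∼b g) (cong (λ z → g z ℕ.+ count g b) (sym x≡y)))

sortDesc-cong : ∀ {n} {a b : Vec ℕ n} → SameMultiset a b → sortDesc a ≡ sortDesc b
sortDesc-cong {a = a} {b} a∼b =
  isDecr-sameMultiset⇒≡ (sortDesc a) (sortDesc b) (isDecr-sortDesc a) (isDecr-sortDesc b)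
    (sameMultiset λ g → trans (count-≡ (sortDesc-sameMultiset a) g)
                       (trans (count-≡ a∼b g) (sym (count-≡ (sortDesc-sameMultiset b) g))))

mult-lookup : ∀ {n} (v : Vec ℕ n) k → 1 ≤ mult (lookup v k) v
mult-lookup (x ∷ v) zero    = mult-∷-self x v
mult-lookup (x ∷ v) (suc k) = ℕ.≤-trans (mult-lookup v k) (ℕ.m≤n+m _ (δ (lookup v k) x))

mult-allLe : ∀ {n} p j (v : Vec ℕ n) → allLe p v ≡ true → p < j → mult j v ≡ 0
mult-allLe p j []      _   _   = refl
mult-allLe p j (x ∷ v) x∷v≤p p<j with ∧-true {x ≤ᵇ p} x∷v≤p
... | x≤p , v≤p rewrite ≢⇒≡ᵇ-false {x} {j} (λ x≡j → ℕ.<⇒≱ p<j (subst (_≤ p) x≡j (≤ᵇ-true⇒≤ x≤p))) =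
  mult-allLe p j v v≤p p<j

nonzeros+mult0≡length : ∀ {n} (v : Vec ℕ n) → nonzeros v ℕ.+ mult 0 v ≡ n
nonzeros+mult0≡length []          = refl
nonzeros+mult0≡length (zero  ∷ v) = trans (ℕ.+-suc (nonzeros v) (mult 0 v)) (cong suc (nonzeros+mult0≡length v))
nonzeros+mult0≡length (suc x ∷ v) = cong suc (nonzeros+mult0≡length v)

allLe-lookup : ∀ {n} p (v : Vec ℕ n) k → allLe p v ≡ true → lookup v k ≤ p
allLe-lookup p (x ∷ v) zero    x∷v≤p = ≤ᵇ-true⇒≤ (proj₁ (∧-true {x ≤ᵇ p} x∷v≤p))
allLe-lookup p (x ∷ v) (suc k) x∷v≤p = allLe-lookup p v k (proj₂ (∧-true {x ≤ᵇ p} x∷v≤p))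

allLe-[]≔ : ∀ {n} p (v : Vec ℕ n) k x → allLe p v ≡ true → x ≤ p → allLe p (v [ k ]≔ x) ≡ true
allLe-[]≔ p (y ∷ v) zero    x y∷v≤p x≤p rewrite ≤⇒≤ᵇ-true x≤p = proj₂ (∧-true {y ≤ᵇ p} y∷v≤p)
allLe-[]≔ p (y ∷ v) (suc k) x y∷v≤p x≤p with ∧-true {y ≤ᵇ p} y∷v≤p
... | y≤p , v≤p rewrite y≤p = allLe-[]≔ p v k x v≤p x≤p

allLe-swapAt : ∀ {n} p (v : Vec ℕ n) k → allLe p v ≡ true → allLe p (swapAt k v) ≡ true
allLe-swapAt p v k v≤p =
  allLe-[]≔ p (v [ k ]≔ lookup v (next k)) (next k) (lookup v k)
    (allLe-[]≔ p v k _ v≤p (allLe-lookup p v (next k) v≤p)) (allLe-lookup p v k v≤p)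

allLe-insertDesc : ∀ {n} p x (v : Vec ℕ n) → (x ≤ᵇ p) ≡ true → allLe p v ≡ true →
                   allLe p (insertDesc x v) ≡ true
allLe-insertDesc p x []      x≤p _ rewrite x≤p = refl
allLe-insertDesc p x (y ∷ v) x≤p y∷v≤p with y ≤ᵇ x
... | true rewrite x≤p = y∷v≤p
... | false with ∧-true {y ≤ᵇ p} y∷v≤p
... | y≤p , v≤p rewrite y≤p = allLe-insertDesc p x v x≤p v≤p

allLe-sortDesc : ∀ {n} p (v : Vec ℕ n) → allLe p v ≡ true → allLe p (sortDesc v) ≡ true
allLe-sortDesc p []      _ = refl
allLe-sortDesc p (x ∷ v) x∷v≤p with ∧-true {x ≤ᵇ p} x∷v≤p
... | x≤p , v≤p = allLe-insertDesc p x (sortDesc v) x≤p (allLe-sortDesc p v v≤p)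

map-swapAt : ∀ {n} (g : ℕ → ℕ) (v : Vec ℕ n) k → V.map g (swapAt k v) ≡ swapAt k (V.map g v)
map-swapAt g v k = begin
  V.map g ((v [ k ]≔ lookup v (next k)) [ next k ]≔ lookup v k)
    ≡⟨ Vec.map-[]≔ g (v [ k ]≔ lookup v (next k)) (next k) ⟩
  V.map g (v [ k ]≔ lookup v (next k)) [ next k ]≔ g (lookup v k)
    ≡⟨ cong (_[ next k ]≔ g (lookup v k)) (Vec.map-[]≔ g v k) ⟩
  (V.map g v [ k ]≔ g (lookup v (next k))) [ next k ]≔ g (lookup v k)
    ≡⟨ cong₂ (λ y z → (V.map g v [ k ]≔ y) [ next k ]≔ z)
             (sym (Vec.lookup-map (next k) g v)) (sym (Vec.lookup-map k g v)) ⟩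
  swapAt k (V.map g v) ∎
  where open ≡-Reasoning

swapAt-id : ∀ {n} (v : Vec ℕ n) k → lookup v k ≡ lookup v (next k) → swapAt k v ≡ v
swapAt-id v k eq rewrite sym eq | Vec.[]≔-lookup v k | eq = Vec.[]≔-lookup v (next k)

isBinary-map-sgn : ∀ {n} (v : Vec ℕ n) → isBinary (V.map sgn v) ≡ true
isBinary-map-sgn []          = refl
isBinary-map-sgn (zero  ∷ v) = isBinary-map-sgn v
isBinary-map-sgn (suc x ∷ v) = isBinary-map-sgn v

nonzeros-map-sgn : ∀ {n} (v : Vec ℕ n) → nonzeros (V.map sgn v) ≡ nonzeros v
nonzeros-map-sgn []          = refl
nonzeros-map-sgn (zero  ∷ v) = nonzeros-map-sgn v
nonzeros-map-sgn (suc x ∷ v) = cong suc (nonzeros-map-sgn v)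

map-sgn-[]≔ : ∀ {n} (v : Vec ℕ n) k x → sgn x ≡ sgn (lookup v k) → V.map sgn (v [ k ]≔ x) ≡ V.map sgn v
map-sgn-[]≔ v k x same-sgn = begin
  V.map sgn (v [ k ]≔ x)         ≡⟨ Vec.map-[]≔ sgn v k ⟩
  V.map sgn v [ k ]≔ sgn x       ≡⟨ cong (V.map sgn v [ k ]≔_) (trans same-sgn (sym (Vec.lookup-map k sgn v))) ⟩
  V.map sgn v [ k ]≔ lookup (V.map sgn v) k ≡⟨ Vec.[]≔-lookup (V.map sgn v) k ⟩
  V.map sgn v ∎
  where open ≡-Reasoning

nonzeros-[]≔ : ∀ {n} (v : Vec ℕ n) k x → sgn x ≡ sgn (lookup v k) → nonzeros (v [ k ]≔ x) ≡ nonzeros v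
nonzeros-[]≔ v k x same-sgn = begin
  nonzeros (v [ k ]≔ x) ≡⟨ nonzeros≡count (v [ k ]≔ x) ⟩
  count sgn (v [ k ]≔ x) ≡⟨ ℕ.+-cancelʳ-≡ (sgn x) _ _ (begin
    count sgn (v [ k ]≔ x) ℕ.+ sgn x            ≡⟨ cong (count sgn (v [ k ]≔ x) ℕ.+_) same-sgn ⟩
    count sgn (v [ k ]≔ x) ℕ.+ sgn (lookup v k) ≡⟨ count-[]≔ sgn v k x ⟩
    count sgn v ℕ.+ sgn x                       ∎) ⟩
  count sgn v ≡⟨ nonzeros≡count v ⟨
  nonzeros v ∎
  where open ≡-Reasoning

f-InΩ : ∀ {n} p q (v : Vec ℕ n) → InΓ p q v → InΩ p q (f v)
f-InΩ p q v v∈Γ with ∧-true {allLe p v} v∈Γ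
... | v≤p , nz≡q
  rewrite isBinary-map-sgn v | nonzeros-map-sgn v | isDecr-sortDesc v | allLe-sortDesc p v v≤p
        | nonzeros-cong (sortDesc-sameMultiset v) | nz≡q = refl

InΩ-partition : ∀ {n} p q (w l : Vec ℕ n) → InΩ p q (w , l) → allLe p l ≡ true × nonzeros l ≡ q
InΩ-partition p q w l y∈Ω
  with isBinary w | nonzeros w ≡ᵇ q | isDecr l | allLe p l | nonzeros l ≡ᵇ q in nz≡q
... | true | true | true | true | true = refl , ≡ᵇ-true⇒≡ nz≡q

InΓ-swapAt : ∀ {n} p q (μ : Vec ℕ n) k → InΓ p q μ → InΓ p q (swapAt k μ)
InΓ-swapAt p q μ k μ∈Γ with ∧-true {allLe p μ} μ∈Γ
... | μ≤p , nz≡q rewrite allLe-swapAt p μ k μ≤p | nonzeros-cong (swapAt-sameMultiset k μ) = nz≡q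

InΓ-[]≔ : ∀ {n} p q (μ : Vec ℕ n) k x → InΓ p q μ → x ≤ p → sgn x ≡ sgn (lookup μ k) →
          InΓ p q (μ [ k ]≔ x)
InΓ-[]≔ p q μ k x μ∈Γ x≤p same-sgn with ∧-true {allLe p μ} μ∈Γ
... | μ≤p , nz≡q rewrite allLe-[]≔ p μ k x μ≤p x≤p | nonzeros-[]≔ μ k x same-sgn = nz≡q

f-swapAt : ∀ {n} (μ : Vec ℕ n) k → f (swapAt k μ) ≡ (swapAt k (V.map sgn μ) , sortDesc μ)
f-swapAt μ k = cong₂ _,_ (map-swapAt sgn μ k) (sortDesc-cong (swapAt-sameMultiset k μ))

sortDesc-[]≔ : ∀ {n} (μ : Vec ℕ n) k x → sortDesc (μ [ k ]≔ x) ≡ changePart (lookup μ k) x (sortDesc μ)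
sortDesc-[]≔ μ k x = sortDesc-cong same
  where
  a = lookup μ k
  a∈sorted : 1 ≤ mult a (sortDesc μ)
  a∈sorted = subst (1 ≤_) (sym (mult-cong (sortDesc-sameMultiset μ) a)) (mult-lookup μ k)
  same : SameMultiset (μ [ k ]≔ x) (replaceFirst a x (sortDesc μ))
  same = sameMultiset λ g → ℕ.+-cancelʳ-≡ (g a) _ _ (trans (count-[]≔ g μ k x) (sym (trans
    (count-replaceFirst g a x (sortDesc μ) a∈sorted)
    (cong (ℕ._+ g x) (count-≡ (sortDesc-sameMultiset μ) g)))))

f-[]≔ : ∀ {n} (μ : Vec ℕ n) k x → sgn x ≡ sgn (lookup μ k) →
        f (μ [ k ]≔ x) ≡ (V.map sgn μ , changePart (lookup μ k) x (sortDesc μ))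
f-[]≔ μ k x same-sgn = cong₂ _,_ (map-sgn-[]≔ μ k x same-sgn) (sortDesc-[]≔ μ k x)

-- Sums over the fibres of f

fiberSum : ∀ {n} p q → Vec ℕ n × Vec ℕ n → (Vec ℕ n → ℚ) → ℚ
fiberSum {n} p q y g = ∑ (allVecs n p) (λ ν → [ isΓ p q ν ∧ (f ν ==Ω y) ]· g ν)

module _ {n} (p q : ℕ) (y : Vec ℕ n × Vec ℕ n) where

  fiberSum-cong : {g h : Vec ℕ n → ℚ} → (∀ ν → g ν ≡ h ν) → fiberSum p q y g ≡ fiberSum p q y h
  fiberSum-cong eq = ∑-cong (allVecs n p) (λ ν → cong ([ isΓ p q ν ∧ (f ν ==Ω y) ]·_) (eq ν))

  fiberSum-+ : (g h : Vec ℕ n → ℚ) → fiberSum p q y (λ ν → g ν + h ν) ≡ fiberSum p q y g + fiberSum p q y h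
  fiberSum-+ g h = trans (∑-cong (allVecs n p) (λ ν → []·-distrib-+ (isΓ p q ν ∧ (f ν ==Ω y)) (g ν) (h ν)))
                         (∑-distrib-+ (allVecs n p) _ _)

  fiberSum-*ˡ : (c : ℚ) (g : Vec ℕ n → ℚ) → fiberSum p q y (λ ν → c * g ν) ≡ c * fiberSum p q y g
  fiberSum-*ˡ c g = trans (∑-cong (allVecs n p) (λ ν → []·-*-comm (isΓ p q ν ∧ (f ν ==Ω y)) c (g ν)))
                          (∑-distribˡ-* (allVecs n p) c _)

  fiberSum-∑ : (ks : List A) (h : Vec ℕ n → A → ℚ) →
               fiberSum p q y (λ ν → ∑ ks (h ν)) ≡ ∑ ks (λ k → fiberSum p q y (λ ν → h ν k))
  fiberSum-∑ ks h = trans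
    (∑-cong (allVecs n p) (λ ν → sym (∑-indicator ks (isΓ p q ν ∧ (f ν ==Ω y)) (h ν))))
    (∑-comm (allVecs n p) ks _)

  fiberSum-point : (c : Bool) (g : Vec ℕ n) (r : ℚ) → (c ≡ true → InΓ p q g) →
                   fiberSum p q y (λ ν → [ c ∧ (g ==v ν) ]· r) ≡ [ c ]· ([ f g ==Ω y ]· r)
  fiberSum-point false g r _    = trans (∑-cong (allVecs n p) (λ ν → []·-zero _)) (∑-zero (allVecs n p))
  fiberSum-point true  g r g∈Γ = begin
    ∑ (allVecs n p) (λ ν → [ isΓ p q ν ∧ (f ν ==Ω y) ]· ([ g ==v ν ]· r))
      ≡⟨ ∑-cong (allVecs n p) (λ ν → []·-comm (isΓ p q ν ∧ (f ν ==Ω y)) (g ==v ν) r) ⟩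
    ∑ (allVecs n p) (λ ν → [ g ==v ν ]· ([ isΓ p q ν ∧ (f ν ==Ω y) ]· r))
      ≡⟨ ∑-allVecs-point n p g _ ⟩
    [ allLe p g ]· ([ isΓ p q g ∧ (f g ==Ω y) ]· r)
      ≡⟨ cong₂ (λ a b → [ a ]· ([ b ∧ (f g ==Ω y) ]· r)) (proj₁ (∧-true {allLe p g} (g∈Γ refl))) (g∈Γ refl) ⟩
    [ f g ==Ω y ]· r ∎
    where open ≡-Reasoning

∑-fiberSum : ∀ n p q (c : Vec ℕ n × Vec ℕ n → Bool) (g : Vec ℕ n → ℚ) →
  ∑ (Ωlist n p q) (λ z → [ c z ]· fiberSum p q z g) ≡ ∑ (Γlist n p q) (λ ν → [ c (f ν) ]· g ν)
∑-fiberSum n p q c g = begin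
  ∑ (Ωlist n p q) (λ z → [ c z ]· fiberSum p q z g)
    ≡⟨ ∑-filterᵇ (isΩ p q) Ω² _ ⟩
  ∑ Ω² (λ z → [ isΩ p q z ]· ([ c z ]· fiberSum p q z g))
    ≡⟨ ∑-cong Ω² (λ z → sym (trans (∑-indicator (allVecs n p) (isΩ p q z) _)
                                    (cong ([ isΩ p q z ]·_) (∑-indicator (allVecs n p) (c z) _)))) ⟩
  ∑ Ω² (λ z → ∑ (allVecs n p) (λ ν → term z ν))
    ≡⟨ ∑-comm Ω² (allVecs n p) term ⟩
  ∑ (allVecs n p) (λ ν → ∑ Ω² (λ z → term z ν))
    ≡⟨ ∑-cong (allVecs n p) fiberOf ⟩
  ∑ (allVecs n p) (λ ν → [ isΓ p q ν ]· ([ c (f ν) ]· g ν))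
    ≡⟨ ∑-filterᵇ (isΓ p q) (allVecs n p) _ ⟨
  ∑ (Γlist n p q) (λ ν → [ c (f ν) ]· g ν) ∎
  where
  open ≡-Reasoning
  Ω² = cartesianProduct (allVecs n 1) (allVecs n p)
  term : Vec ℕ n × Vec ℕ n → Vec ℕ n → ℚ
  term z ν = [ isΩ p q z ]· ([ c z ]· ([ isΓ p q ν ∧ (f ν ==Ω z) ]· g ν))
  fiberOf : ∀ ν → ∑ Ω² (λ z → term z ν) ≡ [ isΓ p q ν ]· ([ c (f ν) ]· g ν)
  fiberOf ν = begin
    ∑ Ω² (λ z → term z ν)
      ≡⟨ ∑-cong Ω² (λ z → trans (cong (λ s → [ isΩ p q z ]· ([ c z ]· s)) ([]·-∧ (isΓ p q ν) _ _))
                                ([]·-float₃ (isΩ p q z) (c z) (isΓ p q ν) (f ν ==Ω z) (g ν))) ⟩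
    ∑ Ω² (λ z → [ f ν ==Ω z ]· ([ isΩ p q z ]· ([ c z ]· ([ isΓ p q ν ]· g ν))))
      ≡⟨ ∑-allVecs²-point n p (f ν) _ ⟩
    [ isBinary (V.map sgn ν) ]· ([ allLe p (sortDesc ν) ]·
      ([ isΩ p q (f ν) ]· ([ c (f ν) ]· ([ isΓ p q ν ]· g ν))))
      ≡⟨ onΓ (isΓ p q ν) refl ⟩
    [ isΓ p q ν ]· ([ c (f ν) ]· g ν) ∎
    where
    onΓ : ∀ b → isΓ p q ν ≡ b →
          [ isBinary (V.map sgn ν) ]· ([ allLe p (sortDesc ν) ]·
            ([ isΩ p q (f ν) ]· ([ c (f ν) ]· ([ b ]· g ν))))
          ≡ [ b ]· ([ c (f ν) ]· g ν)
    onΓ false _ rewrite []·-zero (c (f ν)) | []·-zero (isΩ p q (f ν))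
                      | []·-zero (allLe p (sortDesc ν)) = []·-zero (isBinary (V.map sgn ν))
    onΓ true  ν∈Γ = trans
      (cong₂ (λ a b → [ a ]· ([ b ]· ([ isΩ p q (f ν) ]· ([ c (f ν) ]· g ν))))
             (isBinary-map-sgn ν) (allLe-sortDesc p ν (proj₁ (∧-true {allLe p ν} ν∈Γ))))
      (cong (λ b → [ b ]· ([ c (f ν) ]· g ν)) (f-InΩ p q ν ν∈Γ))

-- Off-diagonal entries

swapRate-by-sign : ∀ (t : ℚ) a b X L → (0 < a → 0 < b → (X ∧ L) ≡ false) →
  [ X ∧ L ]· swapRate t a b
    ≡ [ L ]· ([ (sgn a ≡ᵇ 0) ∧ (sgn b ≡ᵇ 1) ∧ X ]· 1ℚ + [ (sgn a ≡ᵇ 1) ∧ (sgn b ≡ᵇ 0) ∧ X ]· t)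
swapRate-by-sign t zero    zero    X     L     _ rewrite []·-zero (X ∧ L) = sym ([]·-0+0 L)
swapRate-by-sign t zero    (suc b) true  true  _ = refl
swapRate-by-sign t zero    (suc b) true  false _ = refl
swapRate-by-sign t zero    (suc b) false L     _ = sym ([]·-0+0 L)
swapRate-by-sign t (suc a) zero    true  true  _ = sym (+-identityˡ t)
swapRate-by-sign t (suc a) zero    true  false _ = refl
swapRate-by-sign t (suc a) zero    false L     _ = sym ([]·-0+0 L)
swapRate-by-sign t (suc a) (suc b) X     L     both-nonzero rewrite both-nonzero (s≤s z≤n) (s≤s z≤n) =
  sym ([]·-0+0 L)

module OffDiagonal {n} (p q : ℕ) (t u : ℚ) (μ₀ : Vec ℕ n) (μ₀∈Γ : InΓ p q μ₀)
                   (w₁ λ₁ : Vec ℕ n) (y₁∈Ω : InΩ p q (w₁ , λ₁))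
                   (y₀≢y₁ : (f μ₀ ==Ω (w₁ , λ₁)) ≡ false) where

  y₁ : Vec ℕ n × Vec ℕ n
  y₁ = w₁ , λ₁

  w₀ λ₀ : Vec ℕ n
  w₀ = V.map sgn μ₀
  λ₀ = sortDesc μ₀

  a : Fin n → ℕ
  a = lookup μ₀

  μ₀≤p : allLe p μ₀ ≡ true
  μ₀≤p = proj₁ (∧-true {allLe p μ₀} μ₀∈Γ)

  λ₁≤p : allLe p λ₁ ≡ true
  λ₁≤p = proj₁ (InΩ-partition p q w₁ λ₁ y₁∈Ω)

  nonzeros-λ₁ : nonzeros λ₁ ≡ q
  nonzeros-λ₁ = proj₂ (InΩ-partition p q w₁ λ₁ y₁∈Ω)

  -- moveRate, wordTerm and partTerm repeat the where-local summands of Poff and Qoff,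
  -- so that Poff and Qoff unfold to sums of them.
  moveRate : Vec ℕ n → Fin n → ℚ
  moveRate ν k =
      ([ swapAt k μ₀ ==v ν ]· swapRate t (a k) (a (next k)))
    + ([ (1 ≤ᵇ a k) ∧ (suc (a k) ≤ᵇ p) ∧ ((μ₀ [ k ]≔ suc (a k)) ==v ν) ]· u)
    + ([ (2 ≤ᵇ a k) ∧ ((μ₀ [ k ]≔ (a k ∸ 1)) ==v ν) ]· 1ℚ)

  swapMass incMass decMass : Fin n → ℚ
  swapMass k = [ f (swapAt k μ₀) ==Ω y₁ ]· swapRate t (a k) (a (next k))
  incMass  k = [ (1 ≤ᵇ a k) ∧ (suc (a k) ≤ᵇ p) ]· ([ f (μ₀ [ k ]≔ suc (a k)) ==Ω y₁ ]· u)
  decMass  k = [ 2 ≤ᵇ a k ]· ([ f (μ₀ [ k ]≔ (a k ∸ 1)) ==Ω y₁ ]· 1ℚ)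

  fiberSum-moveRate : ∀ k → fiberSum p q y₁ (λ ν → moveRate ν k) ≡ swapMass k + incMass k + decMass k
  fiberSum-moveRate k = begin
    fiberSum p q y₁ (λ ν → moveRate ν k)
      ≡⟨ fiberSum-+ p q y₁ _ _ ⟩
    fiberSum p q y₁ (λ ν → swap ν + inc ν) + fiberSum p q y₁ dec
      ≡⟨ cong (_+ fiberSum p q y₁ dec) (fiberSum-+ p q y₁ swap inc) ⟩
    fiberSum p q y₁ swap + fiberSum p q y₁ inc + fiberSum p q y₁ dec
      ≡⟨ cong₂ (λ x y → x + y + fiberSum p q y₁ dec)
               (fiberSum-point p q y₁ true (swapAt k μ₀) _ (λ _ → InΓ-swapAt p q μ₀ k μ₀∈Γ))
               (trans (fiberSum-cong p q y₁ (λ ν → cong (λ b → [ b ]· u) (sym (∧-assoc (1 ≤ᵇ a k) _ _))))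
                      (fiberSum-point p q y₁ _ (μ₀ [ k ]≔ suc (a k)) u inc∈Γ)) ⟩
    swapMass k + incMass k + fiberSum p q y₁ dec
      ≡⟨ cong (swapMass k + incMass k +_) (fiberSum-point p q y₁ _ (μ₀ [ k ]≔ (a k ∸ 1)) 1ℚ dec∈Γ) ⟩
    swapMass k + incMass k + decMass k ∎
    where
    open ≡-Reasoning
    swap inc dec : Vec ℕ n → ℚ
    swap ν = [ swapAt k μ₀ ==v ν ]· swapRate t (a k) (a (next k))
    inc  ν = [ (1 ≤ᵇ a k) ∧ (suc (a k) ≤ᵇ p) ∧ ((μ₀ [ k ]≔ suc (a k)) ==v ν) ]· u
    dec  ν = [ (2 ≤ᵇ a k) ∧ ((μ₀ [ k ]≔ (a k ∸ 1)) ==v ν) ]· 1ℚ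
    inc∈Γ : ((1 ≤ᵇ a k) ∧ (suc (a k) ≤ᵇ p)) ≡ true → InΓ p q (μ₀ [ k ]≔ suc (a k))
    inc∈Γ cond with ∧-true {1 ≤ᵇ a k} cond
    ... | 1≤a , a<p = InΓ-[]≔ p q μ₀ k _ μ₀∈Γ (≤ᵇ-true⇒≤ a<p) (sgn-suc (a k) (≤ᵇ-true⇒≤ 1≤a))
    dec∈Γ : (2 ≤ᵇ a k) ≡ true → InΓ p q (μ₀ [ k ]≔ (a k ∸ 1))
    dec∈Γ 2≤a = InΓ-[]≔ p q μ₀ k _ μ₀∈Γ (ℕ.≤-trans (ℕ.m∸n≤m (a k) 1) (allLe-lookup p μ₀ k μ₀≤p))
                        (sgn-pred (a k) (≤ᵇ-true⇒≤ 2≤a))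

  fiberSum-Poff : fiberSum p q y₁ (Poff n p t u μ₀)
                ≡ inv3n n * ∑ (allFin n) (λ k → swapMass k + incMass k + decMass k)
  fiberSum-Poff = begin
    fiberSum p q y₁ (λ ν → inv3n n * ∑ (allFin n) (moveRate ν))
      ≡⟨ fiberSum-*ˡ p q y₁ (inv3n n) _ ⟩
    inv3n n * fiberSum p q y₁ (λ ν → ∑ (allFin n) (moveRate ν))
      ≡⟨ cong (inv3n n *_) (fiberSum-∑ p q y₁ (allFin n) moveRate) ⟩
    inv3n n * ∑ (allFin n) (λ k → fiberSum p q y₁ (λ ν → moveRate ν k))
      ≡⟨ cong (inv3n n *_) (∑-cong (allFin n) fiberSum-moveRate) ⟩
    inv3n n * ∑ (allFin n) (λ k → swapMass k + incMass k + decMass k) ∎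
    where open ≡-Reasoning

  wordTerm : Fin n → ℚ
  wordTerm k =
      ([ (lookup w₀ k ≡ᵇ 0) ∧ (lookup w₀ (next k) ≡ᵇ 1) ∧ (swapAt k w₀ ==v w₁) ]· 1ℚ)
    + ([ (lookup w₀ k ≡ᵇ 1) ∧ (lookup w₀ (next k) ≡ᵇ 0) ∧ (swapAt k w₀ ==v w₁) ]· t)

  swapMass≡ : ∀ k → swapMass k ≡ [ λ₀ ==v λ₁ ]· wordTerm k
  swapMass≡ k = begin
    swapMass k
      ≡⟨ cong (λ z → [ z ==Ω y₁ ]· swapRate t (a k) (a (next k))) (f-swapAt μ₀ k) ⟩
    [ (swapAt k w₀ ==v w₁) ∧ (λ₀ ==v λ₁) ]· swapRate t (a k) (a (next k))
      ≡⟨ swapRate-by-sign t (a k) (a (next k)) (swapAt k w₀ ==v w₁) (λ₀ ==v λ₁) no-move ⟩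
    [ λ₀ ==v λ₁ ]· ([ (sgn (a k) ≡ᵇ 0) ∧ (sgn (a (next k)) ≡ᵇ 1) ∧ (swapAt k w₀ ==v w₁) ]· 1ℚ
                  + [ (sgn (a k) ≡ᵇ 1) ∧ (sgn (a (next k)) ≡ᵇ 0) ∧ (swapAt k w₀ ==v w₁) ]· t)
      ≡⟨ cong₂ (λ x y → [ λ₀ ==v λ₁ ]· ([ (x ≡ᵇ 0) ∧ (y ≡ᵇ 1) ∧ (swapAt k w₀ ==v w₁) ]· 1ℚ
                                      + [ (x ≡ᵇ 1) ∧ (y ≡ᵇ 0) ∧ (swapAt k w₀ ==v w₁) ]· t))
               (sym (Vec.lookup-map k sgn μ₀)) (sym (Vec.lookup-map (next k) sgn μ₀)) ⟩
    [ λ₀ ==v λ₁ ]· wordTerm k ∎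
    where
    open ≡-Reasoning
    sgn-pos : ∀ x → 0 < x → sgn x ≡ 1
    sgn-pos (suc x) _ = refl
    -- between two nonzero entries a swap fixes f μ₀, which is not y₁
    no-move : 0 < a k → 0 < a (next k) → ((swapAt k w₀ ==v w₁) ∧ (λ₀ ==v λ₁)) ≡ false
    no-move 0<a 0<a′ rewrite swapAt-id w₀ k (begin
      lookup w₀ k        ≡⟨ Vec.lookup-map k sgn μ₀ ⟩
      sgn (a k)          ≡⟨ trans (sgn-pos (a k) 0<a) (sym (sgn-pos (a (next k)) 0<a′)) ⟩
      sgn (a (next k))   ≡⟨ Vec.lookup-map (next k) sgn μ₀ ⟨
      lookup w₀ (next k) ∎) = y₀≢y₁

  incAt decAt : ℕ → ℚ
  incAt i = [ (1 ≤ᵇ i) ∧ (suc i ≤ᵇ p) ]· ([ (w₀ , changePart i (suc i) λ₀) ==Ω y₁ ]· u)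
  decAt i = [ 2 ≤ᵇ i ]· ([ (w₀ , changePart i (i ∸ 1) λ₀) ==Ω y₁ ]· 1ℚ)

  incMass≡ : ∀ k → incMass k ≡ incAt (a k)
  incMass≡ k with (1 ≤ᵇ a k) ∧ (suc (a k) ≤ᵇ p) in cond
  ... | false = refl
  ... | true  = cong (λ z → [ z ==Ω y₁ ]· u)
                     (f-[]≔ μ₀ k _ (sgn-suc (a k) (≤ᵇ-true⇒≤ (proj₁ (∧-true {1 ≤ᵇ a k} cond)))))

  decMass≡ : ∀ k → decMass k ≡ decAt (a k)
  decMass≡ k with 2 ≤ᵇ a k in cond
  ... | false = refl
  ... | true  = cong (λ z → [ z ==Ω y₁ ]· 1ℚ) (f-[]≔ μ₀ k _ (sgn-pred (a k) (≤ᵇ-true⇒≤ cond)))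

  incRate decRate : ℕ → ℚ
  incRate i = [ λ₁ ==v changePart i (suc i) λ₀ ]· u
  decRate i = [ λ₁ ==v changePart i (i ∸ 1) λ₀ ]· 1ℚ

  -- Q also lists the moves raising a part p and lowering a part 1; their targets
  -- leave Ω, so they never produce λ₁.
  changePart-above-p : ∀ i → p < suc i → 1 ≤ mult i λ₀ → (λ₁ ==v changePart i (suc i) λ₀) ≡ false
  changePart-above-p i p<1+i i∈λ₀ = ≢⇒==v-false {a = λ₁} λ λ₁≡ → ℕ.0≢1+n (begin
    0                                   ≡⟨ mult-allLe p (suc i) λ₁ λ₁≤p p<1+i ⟨
    mult (suc i) λ₁                     ≡⟨ cong (mult (suc i)) λ₁≡ ⟩
    mult (suc i) (changePart i (suc i) λ₀) ≡⟨ mult-changePart-target i (suc i) λ₀ i∈λ₀ (ℕ.1+n≢n ∘ sym) ⟩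
    suc (mult (suc i) λ₀)               ∎)
    where open ≡-Reasoning

  changePart-to-zero : ∀ i → i ≢ 0 → 1 ≤ mult i λ₀ → (λ₁ ==v changePart i 0 λ₀) ≡ false
  changePart-to-zero i i≢0 i∈λ₀ = ≢⇒==v-false {a = λ₁} λ λ₁≡ → ℕ.1+n≢n (sym (begin
    mult 0 λ₀                           ≡⟨ ℕ.+-cancelˡ-≡ q _ _ (trans (cong (ℕ._+ mult 0 λ₀) (sym nonzeros-λ₀))
                                             (trans (nonzeros+mult0≡length λ₀)
                                             (sym (trans (cong (ℕ._+ mult 0 λ₁) (sym nonzeros-λ₁))
                                                         (nonzeros+mult0≡length λ₁))))) ⟩
    mult 0 λ₁                           ≡⟨ cong (mult 0) λ₁≡ ⟩
    mult 0 (changePart i 0 λ₀)          ≡⟨ mult-changePart-target i 0 λ₀ i∈λ₀ i≢0 ⟩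
    suc (mult 0 λ₀)                     ∎))
    where
    open ≡-Reasoning
    nonzeros-λ₀ : nonzeros λ₀ ≡ q
    nonzeros-λ₀ = trans (nonzeros-cong (sortDesc-sameMultiset μ₀))
                        (≡ᵇ-true⇒≡ (proj₂ (∧-true {allLe p μ₀} μ₀∈Γ)))

  incAt≡ : ∀ i → 1 ≤ i → 1 ≤ mult i λ₀ → incAt i ≡ [ w₀ ==v w₁ ]· incRate i
  incAt≡ (suc j) _ i∈λ₀ with suc (suc j) ℕ.≤? p
  ... | yes 2+j≤p rewrite ≤⇒≤ᵇ-true 2+j≤p =
    trans ([]·-∧ (w₀ ==v w₁) _ u) (cong (λ b → [ w₀ ==v w₁ ]· ([ b ]· u)) (==v-sym _ λ₁))
  ... | no  2+j≰p rewrite ≰⇒≤ᵇ-false 2+j≰p | changePart-above-p (suc j) (ℕ.≰⇒> 2+j≰p) i∈λ₀ =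
    sym ([]·-zero (w₀ ==v w₁))

  decAt≡ : ∀ i → 1 ≤ i → 1 ≤ mult i λ₀ → decAt i ≡ [ w₀ ==v w₁ ]· decRate i
  decAt≡ (suc zero)    _ i∈λ₀ rewrite changePart-to-zero 1 (λ ()) i∈λ₀ = sym ([]·-zero (w₀ ==v w₁))
  decAt≡ (suc (suc j)) _ i∈λ₀ =
    trans ([]·-∧ (w₀ ==v w₁) _ 1ℚ) (cong (λ b → [ w₀ ==v w₁ ]· ([ b ]· 1ℚ)) (==v-sym _ λ₁))

  partTerm : ℕ → ℚ
  partTerm i =
      ([ λ₁ ==v changePart i (suc i) λ₀ ]· (ℕtoℚ (mult i λ₀) * u))
    + ([ λ₁ ==v changePart i (i ∸ 1) λ₀ ]· ℕtoℚ (mult i λ₀))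

  partTerm≡ : ∀ i → partTerm i ≡ ℕtoℚ (mult i λ₀) * (incRate i + decRate i)
  partTerm≡ i = begin
    [ λ₁ ==v changePart i (suc i) λ₀ ]· (m * u) + [ λ₁ ==v changePart i (i ∸ 1) λ₀ ]· m
      ≡⟨ cong₂ _+_ ([]·-*-comm (λ₁ ==v changePart i (suc i) λ₀) m u)
                   (trans (cong ([ λ₁ ==v changePart i (i ∸ 1) λ₀ ]·_) (sym (*-identityʳ m)))
                          ([]·-*-comm (λ₁ ==v changePart i (i ∸ 1) λ₀) m 1ℚ)) ⟩
    m * incRate i + m * decRate i
      ≡⟨ *-distribˡ-+ m (incRate i) (decRate i) ⟨
    m * (incRate i + decRate i) ∎
    where
    open ≡-Reasoning
    m = ℕtoℚ (mult i λ₀)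

  massAt≡ : ∀ i → 1 ≤ i → ℕtoℚ (mult i μ₀) * incAt i + ℕtoℚ (mult i μ₀) * decAt i
                          ≡ [ w₀ ==v w₁ ]· partTerm i
  massAt≡ i 1≤i = begin
    ℕtoℚ (mult i μ₀) * incAt i + ℕtoℚ (mult i μ₀) * decAt i
      ≡⟨ cong (λ m → ℕtoℚ m * incAt i + ℕtoℚ m * decAt i) (sym (mult-cong (sortDesc-sameMultiset μ₀) i)) ⟩
    ℕtoℚ (mult i λ₀) * incAt i + ℕtoℚ (mult i λ₀) * decAt i
      ≡⟨ weighted (mult i λ₀) (λ 1≤m → 1≤m) ⟩
    [ w₀ ==v w₁ ]· (ℕtoℚ (mult i λ₀) * (incRate i + decRate i))
      ≡⟨ cong ([ w₀ ==v w₁ ]·_) (partTerm≡ i) ⟨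
    [ w₀ ==v w₁ ]· partTerm i ∎
    where
    open ≡-Reasoning
    weighted : ∀ m → (1 ≤ m → 1 ≤ mult i λ₀) →
               ℕtoℚ m * incAt i + ℕtoℚ m * decAt i ≡ [ w₀ ==v w₁ ]· (ℕtoℚ m * (incRate i + decRate i))
    weighted zero    _      = trans (cong₂ _+_ (*-zeroˡ (incAt i)) (*-zeroˡ (decAt i)))
                                    (trans (+-identityˡ 0ℚ) (sym (trans (cong ([ w₀ ==v w₁ ]·_) (*-zeroˡ (incRate i + decRate i)))
                                                                         ([]·-zero (w₀ ==v w₁)))))
    weighted (suc m) occurs = begin
      M * incAt i + M * decAt i
        ≡⟨ *-distribˡ-+ M (incAt i) (decAt i) ⟨
      M * (incAt i + decAt i)
        ≡⟨ cong (M *_) (cong₂ _+_ (incAt≡ i 1≤i (occurs (s≤s z≤n))) (decAt≡ i 1≤i (occurs (s≤s z≤n)))) ⟩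
      M * ([ w₀ ==v w₁ ]· incRate i + [ w₀ ==v w₁ ]· decRate i)
        ≡⟨ cong (M *_) ([]·-distrib-+ (w₀ ==v w₁) (incRate i) (decRate i)) ⟨
      M * ([ w₀ ==v w₁ ]· (incRate i + decRate i))
        ≡⟨ []·-*-comm (w₀ ==v w₁) M _ ⟨
      [ w₀ ==v w₁ ]· (M * (incRate i + decRate i)) ∎
      where M = ℕtoℚ (suc m)

  ∑incMass+∑decMass : ∑ (allFin n) incMass + ∑ (allFin n) decMass
                    ≡ [ w₀ ==v w₁ ]· ∑ (map suc (upTo p)) partTerm
  ∑incMass+∑decMass = begin
    ∑ (allFin n) incMass + ∑ (allFin n) decMass
      ≡⟨ cong₂ _+_ (∑-cong (allFin n) incMass≡) (∑-cong (allFin n) decMass≡) ⟩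
    ∑ (allFin n) (λ k → incAt (a k)) + ∑ (allFin n) (λ k → decAt (a k))
      ≡⟨ cong₂ _+_ (∑-lookup≡∑-mult p μ₀ incAt refl μ₀≤p) (∑-lookup≡∑-mult p μ₀ decAt refl μ₀≤p) ⟩
    ∑ (range 1 p) (λ i → ℕtoℚ (mult i μ₀) * incAt i) + ∑ (range 1 p) (λ i → ℕtoℚ (mult i μ₀) * decAt i)
      ≡⟨ ∑-distrib-+ (range 1 p) _ _ ⟨
    ∑ (range 1 p) (λ i → ℕtoℚ (mult i μ₀) * incAt i + ℕtoℚ (mult i μ₀) * decAt i)
      ≡⟨ ∑-range-cong p 1 (λ i 1≤i _ → massAt≡ i 1≤i) ⟩
    ∑ (range 1 p) (λ i → [ w₀ ==v w₁ ]· partTerm i)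
      ≡⟨ ∑-indicator (range 1 p) (w₀ ==v w₁) partTerm ⟩
    [ w₀ ==v w₁ ]· ∑ (range 1 p) partTerm
      ≡⟨ cong (λ is → [ w₀ ==v w₁ ]· ∑ is partTerm) map-suc-upTo ⟨
    [ w₀ ==v w₁ ]· ∑ (map suc (upTo p)) partTerm ∎
    where
    open ≡-Reasoning
    map-suc-upTo : map suc (upTo p) ≡ range 1 p
    map-suc-upTo = trans (List.map-applyUpTo (λ i → i) suc p) (applyUpTo≡range p 1 suc (λ _ → refl))

  fiberSum-Poff≡Qoff : fiberSum p q y₁ (Poff n p t u μ₀) ≡ Qoff n p t u (f μ₀) y₁
  fiberSum-Poff≡Qoff = trans fiberSum-Poff (cong (inv3n n *_) (begin
    ∑ (allFin n) (λ k → swapMass k + incMass k + decMass k)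
      ≡⟨ ∑-distrib-+ (allFin n) (λ k → swapMass k + incMass k) decMass ⟩
    ∑ (allFin n) (λ k → swapMass k + incMass k) + ∑ (allFin n) decMass
      ≡⟨ cong (_+ ∑ (allFin n) decMass) (∑-distrib-+ (allFin n) swapMass incMass) ⟩
    ∑ (allFin n) swapMass + ∑ (allFin n) incMass + ∑ (allFin n) decMass
      ≡⟨ xy∙z≈yz∙x (∑ (allFin n) swapMass) _ _ ⟩
    (∑ (allFin n) incMass + ∑ (allFin n) decMass) + ∑ (allFin n) swapMass
      ≡⟨ cong₂ _+_ ∑incMass+∑decMass
                   (trans (∑-cong (allFin n) swapMass≡) (∑-indicator (allFin n) (λ₀ ==v λ₁) wordTerm)) ⟩
    [ w₀ ==v w₁ ]· ∑ (map suc (upTo p)) partTerm + [ λ₀ ==v λ₁ ]· ∑ (allFin n) wordTerm ∎))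
    where open ≡-Reasoning

fiberSum-Poff≡Qoff : ∀ {n} p q t u (μ₀ : Vec ℕ n) → InΓ p q μ₀ → ∀ y₁ → InΩ p q y₁ →
                       (f μ₀ ==Ω y₁) ≡ false → fiberSum p q y₁ (Poff n p t u μ₀) ≡ Qoff n p t u (f μ₀) y₁
fiberSum-Poff≡Qoff p q t u μ₀ μ₀∈Γ (w₁ , λ₁) = OffDiagonal.fiberSum-Poff≡Qoff p q t u μ₀ μ₀∈Γ w₁ λ₁

-- Diagonal entries

module Diagonal {n} (p q : ℕ) (t u : ℚ) (μ₀ : Vec ℕ n) (μ₀∈Γ : InΓ p q μ₀) where

  y₀ : Vec ℕ n × Vec ℕ n
  y₀ = f μ₀

  escape : ℚ
  escape = ∑ (Γlist n p q) (λ ν → [ not (f ν ==Ω y₀) ]· Poff n p t u μ₀ ν)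

  leave withinFiber : ℚ
  leave       = ∑ (filterᵇ (λ ν → not (μ₀ ==v ν)) (Γlist n p q)) (Poff n p t u μ₀)
  withinFiber = ∑ (allVecs n p) (λ ν → [ isΓ p q ν ∧ (f ν ==Ω y₀) ]· ([ not (μ₀ ==v ν) ]· Poff n p t u μ₀ ν))

  leave≡ : leave ≡ withinFiber + escape
  leave≡ = begin
    leave
      ≡⟨ ∑-filterᵇ _ (Γlist n p q) _ ⟩
    ∑ (Γlist n p q) (λ ν → [ not (μ₀ ==v ν) ]· Poff n p t u μ₀ ν)
      ≡⟨ ∑-filterᵇ (isΓ p q) (allVecs n p) _ ⟩
    ∑ (allVecs n p) (λ ν → [ isΓ p q ν ]· ([ not (μ₀ ==v ν) ]· Poff n p t u μ₀ ν))
      ≡⟨ ∑-cong (allVecs n p) (λ ν → []·-split (isΓ p q ν) (not (μ₀ ==v ν)) (f ν ==Ω y₀) _ (same-fiber ν)) ⟩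
    ∑ (allVecs n p) (λ ν → [ isΓ p q ν ∧ (f ν ==Ω y₀) ]· ([ not (μ₀ ==v ν) ]· Poff n p t u μ₀ ν)
                         + [ isΓ p q ν ]· ([ not (f ν ==Ω y₀) ]· Poff n p t u μ₀ ν))
      ≡⟨ ∑-distrib-+ (allVecs n p) _ _ ⟩
    withinFiber + ∑ (allVecs n p) (λ ν → [ isΓ p q ν ]· ([ not (f ν ==Ω y₀) ]· Poff n p t u μ₀ ν))
      ≡⟨ cong (withinFiber +_) (∑-filterᵇ (isΓ p q) (allVecs n p) _) ⟨
    withinFiber + escape ∎
    where
    open ≡-Reasoning
    same-fiber : ∀ ν → not (μ₀ ==v ν) ≡ false → (f ν ==Ω y₀) ≡ true
    same-fiber ν μ₀=ν rewrite sym (==v-true⇒≡ {a = μ₀} {ν} (not-false⇒true μ₀=ν)) = ==Ω-refl y₀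

  fiberSum-P : fiberSum p q y₀ (P n p q t u μ₀) ≡ 1ℚ - escape
  fiberSum-P = begin
    fiberSum p q y₀ (P n p q t u μ₀)
      ≡⟨ ∑-cong (allVecs n p) (λ ν → []·-if (isΓ p q ν ∧ (f ν ==Ω y₀)) (μ₀ ==v ν) (1ℚ - leave) _ (fiber-of-μ₀ ν)) ⟩
    ∑ (allVecs n p) (λ ν → [ μ₀ ==v ν ]· (1ℚ - leave)
                         + [ isΓ p q ν ∧ (f ν ==Ω y₀) ]· ([ not (μ₀ ==v ν) ]· Poff n p t u μ₀ ν))
      ≡⟨ ∑-distrib-+ (allVecs n p) _ _ ⟩
    ∑ (allVecs n p) (λ ν → [ μ₀ ==v ν ]· (1ℚ - leave)) + withinFiber
      ≡⟨ cong (_+ withinFiber) (trans (∑-allVecs-point n p μ₀ _)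
                                      (cong (λ b → [ b ]· (1ℚ - leave)) (proj₁ (∧-true {allLe p μ₀} μ₀∈Γ)))) ⟩
    (1ℚ - leave) + withinFiber
      ≡⟨ cong (λ l → (1ℚ - l) + withinFiber) leave≡ ⟩
    (1ℚ - (withinFiber + escape)) + withinFiber
      ≡⟨ solve 2 (λ A B → (con 1ℚ :- (A :+ B)) :+ A := con 1ℚ :- B) refl withinFiber escape ⟩
    1ℚ - escape ∎
    where
    open ≡-Reasoning
    open ℚSolver.+-*-Solver
    fiber-of-μ₀ : ∀ ν → (μ₀ ==v ν) ≡ true → (isΓ p q ν ∧ (f ν ==Ω y₀)) ≡ true
    fiber-of-μ₀ ν μ₀=ν rewrite sym (==v-true⇒≡ {a = μ₀} {ν} μ₀=ν) | μ₀∈Γ = ==Ω-refl y₀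

  Q-diagonal : Q n p q t u y₀ y₀ ≡ 1ℚ - escape
  Q-diagonal rewrite ==Ω-refl y₀ = cong (1ℚ -_) (begin
    ∑ (filterᵇ (λ z → not (y₀ ==Ω z)) (Ωlist n p q)) (Qoff n p t u y₀)
      ≡⟨ ∑-filterᵇ (λ z → not (y₀ ==Ω z)) (Ωlist n p q) _ ⟩
    ∑ (Ωlist n p q) (λ z → [ not (y₀ ==Ω z) ]· Qoff n p t u y₀ z)
      ≡⟨ ∑-filterᵇ-cong (isΩ p q) (cartesianProduct (allVecs n 1) (allVecs n p)) off-diagonal ⟩
    ∑ (Ωlist n p q) (λ z → [ not (y₀ ==Ω z) ]· fiberSum p q z (Poff n p t u μ₀))
      ≡⟨ ∑-fiberSum n p q (λ z → not (y₀ ==Ω z)) (Poff n p t u μ₀) ⟩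
    ∑ (Γlist n p q) (λ ν → [ not (y₀ ==Ω f ν) ]· Poff n p t u μ₀ ν)
      ≡⟨ ∑-cong (Γlist n p q) (λ ν → cong (λ b → [ not b ]· Poff n p t u μ₀ ν) (==Ω-sym y₀ (f ν))) ⟩
    escape ∎)
    where
    open ≡-Reasoning
    off-diagonal : ∀ z → isΩ p q z ≡ true →
                   [ not (y₀ ==Ω z) ]· Qoff n p t u y₀ z ≡ [ not (y₀ ==Ω z) ]· fiberSum p q z (Poff n p t u μ₀)
    off-diagonal z z∈Ω with y₀ ==Ω z in y₀≟z
    ... | true  = refl
    ... | false = sym (fiberSum-Poff≡Qoff p q t u μ₀ μ₀∈Γ z z∈Ω y₀≟z)

∑-fiber≡fiberSum : ∀ n p q (y : Vec ℕ n × Vec ℕ n) (g : Vec ℕ n → ℚ) →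
                   ∑ (filterᵇ (λ ν → f ν ==Ω y) (Γlist n p q)) g ≡ fiberSum p q y g
∑-fiber≡fiberSum n p q y g = begin
  ∑ (filterᵇ (λ ν → f ν ==Ω y) (Γlist n p q)) g
    ≡⟨ ∑-filterᵇ _ (Γlist n p q) g ⟩
  ∑ (Γlist n p q) (λ ν → [ f ν ==Ω y ]· g ν)
    ≡⟨ ∑-filterᵇ (isΓ p q) (allVecs n p) _ ⟩
  ∑ (allVecs n p) (λ ν → [ isΓ p q ν ]· ([ f ν ==Ω y ]· g ν))
    ≡⟨ ∑-cong (allVecs n p) (λ ν → sym ([]·-∧ (isΓ p q ν) (f ν ==Ω y) (g ν))) ⟩
  fiberSum p q y g ∎
  where open ≡-Reasoning

fiberSum-P≡Q : ∀ {n} p q t u (μ₀ : Vec ℕ n) → InΓ p q μ₀ → ∀ y₁ → InΩ p q y₁ →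
               fiberSum p q y₁ (P n p q t u μ₀) ≡ Q n p q t u (f μ₀) y₁
fiberSum-P≡Q {n} p q t u μ₀ μ₀∈Γ y₁ y₁∈Ω = by-cases (f μ₀ ==Ω y₁) refl
  where
  by-cases : ∀ b → (f μ₀ ==Ω y₁) ≡ b → fiberSum p q y₁ (P n p q t u μ₀) ≡ Q n p q t u (f μ₀) y₁
  by-cases true y₀=y₁ = subst (λ y → fiberSum p q y (P n p q t u μ₀) ≡ Q n p q t u (f μ₀) y)
    (==Ω-true⇒≡ y₀=y₁)
    (trans (Diagonal.fiberSum-P p q t u μ₀ μ₀∈Γ) (sym (Diagonal.Q-diagonal p q t u μ₀ μ₀∈Γ)))
  by-cases false y₀≠y₁ = begin
    fiberSum p q y₁ (P n p q t u μ₀)   ≡⟨ ∑-cong (allVecs n p) P≡Poff ⟩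
    fiberSum p q y₁ (Poff n p t u μ₀)  ≡⟨ fiberSum-Poff≡Qoff p q t u μ₀ μ₀∈Γ y₁ y₁∈Ω y₀≠y₁ ⟩
    Qoff n p t u (f μ₀) y₁             ≡⟨ Qoff≡Q ⟩
    Q n p q t u (f μ₀) y₁              ∎
    where
    open ≡-Reasoning
    Qoff≡Q : Qoff n p t u (f μ₀) y₁ ≡ Q n p q t u (f μ₀) y₁
    Qoff≡Q rewrite y₀≠y₁ = refl
    P≡Poff : ∀ ν → [ isΓ p q ν ∧ (f ν ==Ω y₁) ]· P n p q t u μ₀ ν
                 ≡ [ isΓ p q ν ∧ (f ν ==Ω y₁) ]· Poff n p t u μ₀ ν
    P≡Poff ν with μ₀ ==v ν in μ₀=ν
    ... | false = refl
    ... | true rewrite sym (==v-true⇒≡ {a = μ₀} {ν} μ₀=ν) | μ₀∈Γ | y₀≠y₁ = refl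

theorem2p3 : (n p q : ℕ) → 1 ≤ p → 1 ≤ q → q < n →
    (t u : ℚ) → 0ℚ ≤ℚ t → t ≤ℚ 1ℚ → 0ℚ ≤ℚ u → u ≤ℚ 1ℚ →
    (y₀ y₁ : Vec ℕ n × Vec ℕ n) → InΩ p q y₀ → InΩ p q y₁ →
    (μ₀ : Vec ℕ n) → InΓ p q μ₀ → f μ₀ ≡ y₀ →
    sumℚ (map (P n p q t u μ₀) (filterᵇ (λ μ → f μ ==Ω y₁) (Γlist n p q)))
    ≡ Q n p q t u y₀ y₁
theorem2p3 n p q _ _ _ t u _ _ _ _ y₀ y₁ _ y₁∈Ω μ₀ μ₀∈Γ refl =
  trans (∑-fiber≡fiberSum n p q y₁ (P n p q t u μ₀)) (fiberSum-P≡Q p q t u μ₀ μ₀∈Γ y₁ y₁∈Ω)
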